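{- Let $x_1,\dots,x_5$ be indeterminates and work in $\bigotimes^5\big(\mathbb{Q}(x_1,\dots,x_5)^\times\otimes\mathbb{Q}\big)$. Define \[\mathrm{CR}(x_1,x_2,x_3,x_4)=\frac{(x_1-x_3)(x_2-x_4)}{(x_1-x_4)(x_2-x_3)},\] \[R_1=-\frac{(x_{1}-x_{2}) (x_{1}-x_{4}) (x_{3}-x_{5})}{(x_{1}-x_{3}) (x_{1}-x_{5}) (x_{2}-x_{4})},\qquad R_2=-\frac{(x_{1}-x_{2})^2(x_{3}-x_{4}) (x_{3}-x_{5})}{(x_{1}-x_{3}) (x_{1}-x_{4}) (x_{2}-x_{3}) (x_{2}-x_{5})},\] \[R_3=-\frac{(x_{1}-x_{2})^3 (x_{1}-x_{5}) (x_{3}-x_{4})^2 (x_{3}-x_{5})}{(x_{1}-x_{3})^3 (x_{1}-x_{4}) (x_{2}-x_{4}) (x_{2}-x_{5})^2},\] regarded as functions $R_j(x_1,\dots,x_5)$. Then \[\mathrm{Symb}^{\sqcup\!\sqcup}\Big(\mathrm{Alt}_5\Big(11\,S_{3,2}(\mathrm{CR}(x_1,x_2,x_3,x_4))+15\,\mathrm{Li}_5(R_1(x_1,\dots,x_5))-9\,\mathrm{Li}_5(R_2(x_1,\dots,x_5))+\mathrm{Li}_5(R_3(x_1,\dots,x_5))\Big)\Big)=0.\]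
   Context: For integers $n,p\ge1$ the Nielsen polylogarithm is $S_{n,p}(z)=\frac{(-1)^{n+p-1}}{(n-1)!\,p!}\int_0^1\log^{n-1}(t)\log^{p}(1-zt)\frac{dt}{t}$ (weight $n+p$), and $\mathrm{Li}_m(z)=\sum_{k\ge1}z^k/k^m=S_{m-1,1}(z)$. For a function $f(x_1,\dots,x_5)$, $\mathrm{Alt}_5 f=\sum_{\sigma\in\mathfrak{S}_5}\mathrm{sgn}(\sigma)f(x_{\sigma(1)},\dots,x_{\sigma(5)})$. Symbols: elements of $(K^\times\otimes\mathbb{Q})^{\otimes N}$ are written multiplicatively in each slot (so $\dots\otimes ab\otimes\dots=\dots\otimes a\otimes\dots+\dots\otimes b\otimes\dots$, and torsion, in particular signs, is ignored). The symbol of a weight-$N$ polylogarithmic function is defined recursively by $\mathrm{Symb}(\log f)=f$, constants of positive weight (zeta values, $\pi$) have symbol $0$, and if $dF=\sum_iF_i\,d\log f_i$ with $F_i$ of weight $N-1$ then $\mathrm{Symb}(F)=\sum_i\mathrm{Symb}(F_i)\otimes f_i$ (e.g. $\mathrm{Symb}\,\mathrm{Li}_2(z)=-(1-z)\otimes z$). Let $\Pi_1=\mathrm{id}$ and $\Pi_N(a_1\otimes\cdots\otimes a_N)=\frac{N-1}{N}\big(\Pi_{N-1}(a_1\otimes\cdots\otimes a_{N-1})\otimes a_N-\Pi_{N-1}(a_2\otimes\cdots\otimes a_N)\otimes a_1\big)$ (a projector annihilating symbols of products). The mod-products symbol in weight $N$ is $\mathrm{Symb}^{\sqcup\!\sqcup}=N\,\Pi_N\circ\mathrm{Symb}$,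 extended linearly. -}

module Defs where

open import Data.Nat using (ℕ; zero; suc; _<ᵇ_)
open import Data.Nat as ℕ using ()
open import Data.Integer using (ℤ; +_; -[1+_])
open import Data.Rational using (ℚ; 0ℚ; 1ℚ; _+_; _*_; _-_; -_; _/_)
open import Data.Fin using (Fin; zero; suc; toℕ)
open import Data.Fin as F using ()
open import Data.Vec using (Vec; []; _∷_; _[_]≔_)
open import Data.List using (List; []; _∷_; _++_; map; concatMap; filter; foldr; allFin)
open import Data.Product using (_×_; _,_)
open import Data.Bool using (Bool; true; false; _∧_; not; if_then_else_)
open import Relation.Binary.PropositionalEquality using (_≡_)
open import Relation.Nullary using (¬_)
open import Relation.Nullary.Decidable using (does)

-- Polynomials in Q[x1,...,x5] (variables indexed by Fin 5), as
-- expressions; two polynomials are equal iff they agree at every point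
-- of Q^5 (which is polynomial identity since Q is infinite).

infixl 6 _⊕_ _⊖_
infixl 7 _⊛_

data Poly : Set where
  var : Fin 5 → Poly
  con : ℚ → Poly
  _⊕_ : Poly → Poly → Poly
  _⊖_ : Poly → Poly → Poly
  _⊛_ : Poly → Poly → Poly

evalP : (Fin 5 → ℚ) → Poly → ℚ
evalP ρ (var i) = ρ i
evalP ρ (con q) = q
evalP ρ (p ⊕ q) = evalP ρ p + evalP ρ q
evalP ρ (p ⊖ q) = evalP ρ p - evalP ρ q
evalP ρ (p ⊛ q) = evalP ρ p * evalP ρ q

_≈ₚ_ : Poly → Poly → Set
p ≈ₚ q = (ρ : Fin 5 → ℚ) → evalP ρ p ≡ evalP ρ q

NonZeroP : Poly → Set
NonZeroP p = ¬ (p ≈ₚ con 0ℚ)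

renameP : (Fin 5 → Fin 5) → Poly → Poly
renameP σ (var i) = var (σ i)
renameP σ (con q) = con q
renameP σ (p ⊕ q) = renameP σ p ⊕ renameP σ q
renameP σ (p ⊖ q) = renameP σ p ⊖ renameP σ q
renameP σ (p ⊛ q) = renameP σ p ⊛ renameP σ q

record RF : Set where
  constructor _//_
  field
    num : Poly
    den : Poly
open RF public

infix 5 _//_

NonZeroR : RF → Set
NonZeroR f = NonZeroP (num f) × NonZeroP (den f)

_≈ᵣ_ : RF → RF → Set
f ≈ᵣ g = (num f ⊛ den g) ≈ₚ (num g ⊛ den f)

_·ᵣ_ : RF → RF → RF
f ·ᵣ g = (num f ⊛ num g) // (den f ⊛ den g)

oneMinus : RF → RF
oneMinus f = (den f ⊖ num f) // den f

renameR : (Fin 5 → Fin 5) → RF → RF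
renameR σ f = renameP σ (num f) // renameP σ (den f)

-- Formal Q-linear combinations of pure tensors a1 ⊗ ... ⊗ an of
-- elements of K^× (written multiplicatively in each slot).

Tensor : ℕ → Set
Tensor n = List (ℚ × Vec RF n)

scaleT : ∀ {n} → ℚ → Tensor n → Tensor n
scaleT c = map (λ { (d , v) → (c * d , v) })

appendT : ∀ {n} → Tensor n → RF → Tensor (suc n)
appendT t a = map (λ { (d , v) → (d , snoc v) }) t
  where
  snoc : ∀ {m} → Vec RF m → Vec RF (suc m)
  snoc [] = a ∷ []
  snoc (x ∷ xs) = x ∷ snoc xs

initV : ∀ {A : Set} {n} → Vec A (suc n) → Vec A n
initV (x ∷ []) = []
initV (x ∷ y ∷ xs) = x ∷ initV (y ∷ xs)

lastV : ∀ {A : Set} {n} → Vec A (suc n) → A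
lastV (x ∷ []) = x
lastV (x ∷ y ∷ xs) = lastV (y ∷ xs)

tailV : ∀ {A : Set} {n} → Vec A (suc n) → Vec A n
tailV (x ∷ xs) = xs

headV : ∀ {A : Set} {n} → Vec A (suc n) → A
headV (x ∷ xs) = x

Π : (n : ℕ) → Vec RF (suc n) → Tensor (suc n)
Π zero v = (1ℚ , v) ∷ []
Π (suc n) v =
  scaleT (+ suc n / suc (suc n))
    (appendT (Π n (initV v)) (lastV v)
      ++ scaleT (- 1ℚ) (appendT (Π n (tailV v)) (headV v)))

ΠT : ∀ {n} → Tensor (suc n) → Tensor (suc n)
ΠT {n} = concatMap (λ { (c , v) → scaleT c (Π n v) })

data PLog : Set where
  S₃₂ : RF → PLog
  Li₅ : RF → PLog

Fn : Set
Fn = List (ℚ × PLog)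

renamePL : (Fin 5 → Fin 5) → PLog → PLog
renamePL σ (S₃₂ f) = S₃₂ (renameR σ f)
renamePL σ (Li₅ f) = Li₅ (renameR σ f)

-- Symbols (from dS_{n,p} = S_{n-1,p} dlog z, dS_{1,p} = ((-1)^p/p!) log^p(1-z) dlog z):
--   Symb S_{3,2}(z) = (1-z) ⊗ (1-z) ⊗ z ⊗ z ⊗ z
--   Symb Li_5(z)    = −(1-z) ⊗ z ⊗ z ⊗ z ⊗ z
SymbPL : PLog → Tensor 5
SymbPL (S₃₂ z) = (1ℚ , (oneMinus z ∷ oneMinus z ∷ z ∷ z ∷ z ∷ [])) ∷ []
SymbPL (Li₅ z) = (- 1ℚ , (oneMinus z ∷ z ∷ z ∷ z ∷ z ∷ [])) ∷ []

Symb : Fn → Tensor 5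
Symb = concatMap (λ { (c , φ) → scaleT c (SymbPL φ) })

SymbSh : Fn → Tensor 5
SymbSh F = scaleT (+ 5 / 1) (ΠT (Symb F))

tuples : (n k : ℕ) → List (Vec (Fin n) k)
tuples n zero = [] ∷ []
tuples n (suc k) = concatMap (λ i → map (i ∷_) (tuples n k)) (allFin n)

lookupV : ∀ {A : Set} {k} → Vec A k → Fin k → A
lookupV (x ∷ xs) zero = x
lookupV (x ∷ xs) (suc i) = lookupV xs i

pairsLt : (k : ℕ) → List (Fin k × Fin k)
pairsLt k = concatMap (λ i → concatMap (λ j → if toℕ i <ᵇ toℕ j then (i , j) ∷ [] else []) (allFin k)) (allFin k)

injectiveᵇ : ∀ {n k} → Vec (Fin n) k → Bool
injectiveᵇ {k = k} v =
  foldr (λ { (i , j) b → not (does (lookupV v i F.≟ lookupV v j)) ∧ b }) true (pairsLt k)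

perms5 : List (Vec (Fin 5) 5)
perms5 = filter (λ v → Data.Bool.T? (injectiveᵇ v)) (tuples 5 5)
  where import Data.Bool

sgn : Vec (Fin 5) 5 → ℚ
sgn v = foldr (λ { (i , j) s → if toℕ (lookupV v j) <ᵇ toℕ (lookupV v i) then - s else s }) 1ℚ (pairsLt 5)

Alt5 : Fn → Fn
Alt5 F = concatMap (λ σ → map (λ { (c , φ) → (sgn σ * c , renamePL (lookupV σ) φ) }) F) perms5

-- An element of this Q-vector space is 0
-- iff every Q-linear functional kills it, i.e. iff every map
-- B : (K^×)^5 → Q which is a homomorphism (K^×,·) → (Q,+) in each slot
-- (hence kills torsion) sends it to 0.

record Multilinear (B : Vec RF 5 → ℚ) : Set where
  field
    resp : (v : Vec RF 5) (i : Fin 5) (f g : RF) →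
           ((j : Fin 5) → NonZeroR (lookupV v j)) → NonZeroR f → NonZeroR g →
           f ≈ᵣ g → B (v [ i ]≔ f) ≡ B (v [ i ]≔ g)
    mult : (v : Vec RF 5) (i : Fin 5) (f g : RF) →
           ((j : Fin 5) → NonZeroR (lookupV v j)) → NonZeroR f → NonZeroR g →
           B (v [ i ]≔ (f ·ᵣ g)) ≡ B (v [ i ]≔ f) + B (v [ i ]≔ g)

evalT : (Vec RF 5 → ℚ) → Tensor 5 → ℚ
evalT B = foldr (λ { (c , v) s → c * B v + s }) 0ℚ

IsZeroT : Tensor 5 → Set
IsZeroT t = (B : Vec RF 5 → ℚ) → Multilinear B → evalT B t ≡ 0ℚ

x : Fin 5 → Poly
x = var

x₁ x₂ x₃ x₄ x₅ : Poly
x₁ = x zero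
x₂ = x (suc zero)
x₃ = x (suc (suc zero))
x₄ = x (suc (suc (suc zero)))
x₅ = x (suc (suc (suc (suc zero))))

negP : Poly → Poly
negP p = con (- 1ℚ) ⊛ p

CR : RF
CR = ((x₁ ⊖ x₃) ⊛ (x₂ ⊖ x₄)) // ((x₁ ⊖ x₄) ⊛ (x₂ ⊖ x₃))

R₁ : RF
R₁ = negP ((x₁ ⊖ x₂) ⊛ (x₁ ⊖ x₄) ⊛ (x₃ ⊖ x₅))
     // ((x₁ ⊖ x₃) ⊛ (x₁ ⊖ x₅) ⊛ (x₂ ⊖ x₄))

R₂ : RF
R₂ = negP ((x₁ ⊖ x₂) ⊛ (x₁ ⊖ x₂) ⊛ (x₃ ⊖ x₄) ⊛ (x₃ ⊖ x₅))
     // ((x₁ ⊖ x₃) ⊛ (x₁ ⊖ x₄) ⊛ (x₂ ⊖ x₃) ⊛ (x₂ ⊖ x₅))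

R₃ : RF
R₃ = negP ((x₁ ⊖ x₂) ⊛ (x₁ ⊖ x₂) ⊛ (x₁ ⊖ x₂) ⊛ (x₁ ⊖ x₅)
           ⊛ (x₃ ⊖ x₄) ⊛ (x₃ ⊖ x₄) ⊛ (x₃ ⊖ x₅))
     // ((x₁ ⊖ x₃) ⊛ (x₁ ⊖ x₃) ⊛ (x₁ ⊖ x₃) ⊛ (x₁ ⊖ x₄)
           ⊛ (x₂ ⊖ x₄) ⊛ (x₂ ⊖ x₅) ⊛ (x₂ ⊖ x₅))

F₀ : Fn
F₀ = (+ 11 / 1 , S₃₂ CR) ∷ (+ 15 / 1 , Li₅ R₁) ∷ (- (+ 9 / 1) , Li₅ R₂) ∷ (1ℚ , Li₅ R₃) ∷ []

{-# OPTIONS --safe #-}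
module Submission where

-- Unfolding the definitions, the
-- mod-products symbol of F₀ is literally an integer combination of tensors of
-- the eight atoms z and 1 − z (z = CR, R₁, R₂, R₃), and every atom factors, up
-- to sign, over 45 letters: the differences x_i − x_j and the S₅-translates of
-- the numerators of 1 − R₁ and 1 − R₂. By multilinearity, B renamed by a
-- permutation σ becomes a function of 5-tuples of letters, and the alternating
-- sum of these functions over σ is alternating for the action of S₅ on letters,
-- since a transposition of the variables permutes the letters up to sign. So it
-- suffices that the letter tensor vanishes modulo t ∼ sgn(w) w·t, which is
-- decided slot by slot: each letter is moved to the least element of its orbit
-- under the stabiliser of the letters already fixed, and the coefficients of
-- equal tensors must cancel.

open import Defs
open import Algebra.Bundles using (CommutativeMonoid)
open import Data.Bool using (Bool; true; false; T; _∨_; if_then_else_)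
open import Data.Bool.ListAction using (all; any)
open import Data.Bool.Properties using (T-∨; T-≡)
open import Data.Fin using (Fin; zero; suc; toℕ; _≟_; #_; inject₁)
open import Data.Fin.Permutation.Components using (transpose)
open import Data.Fin.Properties using (all?)
open import Data.Integer as ℤ using (ℤ; +_; -[1+_])
import Data.Integer.Properties as ℤₚ
open import Data.List using (List; []; _∷_; _++_; map; concatMap; foldr; filter; null; inits; allFin)
open import Data.List.Membership.Propositional using (_∈_; find)
open import Data.List.Membership.Propositional.Properties using (∈-filter⁻)
open import Data.List.Relation.Unary.All as All using (All; []; _∷_)
import Data.List.Relation.Unary.All.Properties as Allₚ
open import Data.List.Relation.Unary.Any using (here; there)
import Data.List.Relation.Unary.Any.Properties as Anyₚ
import Data.List.Properties as Listₚ
open import Data.Maybe using (Maybe; just; nothing; from-just; maybe′; _<∣>_)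
import Data.Maybe as Maybe
import Data.Nat as ℕ
open import Data.Nat using (ℕ; zero; suc; _<ᵇ_)
open import Data.Product using (_×_; _,_; proj₁; proj₂; map₂)
import Data.Product.Properties as Productₚ
open import Data.Rational using (ℚ; 0ℚ; 1ℚ; ½; toℚᵘ; _+_; _*_; _-_; -_; _/_; 1/_; ≢-nonZero)
import Data.Rational.Properties as ℚ
open import Data.Rational.Solver using (module +-*-Solver)
open import Data.Rational.Unnormalised as ℚᵘ using (mkℚᵘ; *≡*)
import Data.Rational.Unnormalised.Properties as ℚᵘₚ
open import Data.Sum using (_⊎_; inj₁; inj₂)
open import Data.Vec as Vec using (Vec; []; _∷_; _[_]≔_; _∷ʳ_)
import Data.Vec.Properties as Vecₚ
open import Function using (_∘_; id)
open import Function.Bundles using (Equivalence)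
open import Relation.Binary.Definitions using (DecidableEquality)
open import Relation.Binary.PropositionalEquality hiding (resp)
open import Relation.Nullary using (yes; no; does; ¬?)
open import Relation.Nullary.Decidable using (from-yes; toWitness; isYes; T?)

open import Algebra.Properties.CommutativeSemigroup (CommutativeMonoid.commutativeSemigroup ℚ.+-0-commutativeMonoid) using (x∙yz≈y∙xz; interchange)
open +-*-Solver using (solve; _:=_; _:+_; _:*_; _:-_; :-_) renaming (con to :con)

fromℤ : ℤ → ℚ
fromℤ a = a / 1

private
  toℚᵘ-fromℤ : ∀ a → toℚᵘ (fromℤ a) ℚᵘ.≃ mkℚᵘ a 0
  toℚᵘ-fromℤ a = ℚ.toℚᵘ-fromℚᵘ (mkℚᵘ a 0)

fromℤ-+ : ∀ a b → fromℤ (a ℤ.+ b) ≡ fromℤ a + fromℤ b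
fromℤ-+ a b = ℚ.toℚᵘ-injective (begin
  toℚᵘ (fromℤ (a ℤ.+ b))                ≈⟨ toℚᵘ-fromℤ (a ℤ.+ b) ⟩
  mkℚᵘ (a ℤ.+ b) 0                      ≈⟨ *≡* (cong (ℤ._* + 1) (cong₂ ℤ._+_ (sym (ℤₚ.*-identityʳ a)) (sym (ℤₚ.*-identityʳ b)))) ⟩
  mkℚᵘ a 0 ℚᵘ.+ mkℚᵘ b 0                ≈⟨ ℚᵘₚ.+-cong (toℚᵘ-fromℤ a) (toℚᵘ-fromℤ b) ⟨
  toℚᵘ (fromℤ a) ℚᵘ.+ toℚᵘ (fromℤ b)    ≈⟨ ℚ.toℚᵘ-homo-+ (fromℤ a) (fromℤ b) ⟨
  toℚᵘ (fromℤ a + fromℤ b)              ∎)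
  where open ℚᵘₚ.≃-Reasoning

fromℤ-* : ∀ a b → fromℤ (a ℤ.* b) ≡ fromℤ a * fromℤ b
fromℤ-* a b = ℚ.toℚᵘ-injective (begin
  toℚᵘ (fromℤ (a ℤ.* b))                ≈⟨ toℚᵘ-fromℤ (a ℤ.* b) ⟩
  mkℚᵘ a 0 ℚᵘ.* mkℚᵘ b 0                ≈⟨ ℚᵘₚ.*-cong (toℚᵘ-fromℤ a) (toℚᵘ-fromℤ b) ⟨
  toℚᵘ (fromℤ a) ℚᵘ.* toℚᵘ (fromℤ b)    ≈⟨ ℚ.toℚᵘ-homo-* (fromℤ a) (fromℤ b) ⟨
  toℚᵘ (fromℤ a * fromℤ b)              ∎)
  where open ℚᵘₚ.≃-Reasoning

fromℤ-neg : ∀ a → fromℤ (ℤ.- a) ≡ - fromℤ a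
fromℤ-neg a = ℚ.toℚᵘ-injective (begin
  toℚᵘ (fromℤ (ℤ.- a))      ≈⟨ toℚᵘ-fromℤ (ℤ.- a) ⟩
  ℚᵘ.- mkℚᵘ a 0             ≈⟨ ℚᵘₚ.-‿cong (toℚᵘ-fromℤ a) ⟨
  ℚᵘ.- toℚᵘ (fromℤ a)       ≈⟨ ℚ.toℚᵘ-homo‿- (fromℤ a) ⟨
  toℚᵘ (- fromℤ a)          ∎)
  where open ℚᵘₚ.≃-Reasoning

open ≡-Reasoning

*-≢0 : ∀ {p q : ℚ} → p ≢ 0ℚ → q ≢ 0ℚ → p * q ≢ 0ℚ
*-≢0 {p} {q} p≢0 q≢0 pq≡0 = q≢0 (begin
  q                  ≡⟨ ℚ.*-identityˡ q ⟨
  1ℚ * q             ≡⟨ cong (_* q) (ℚ.*-inverseˡ p) ⟨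
  (1/ p * p) * q     ≡⟨ ℚ.*-assoc (1/ p) p q ⟩
  1/ p * (p * q)     ≡⟨ cong (1/ p *_) pq≡0 ⟩
  1/ p * 0ℚ          ≡⟨ ℚ.*-zeroʳ (1/ p) ⟩
  0ℚ                 ∎)
  where instance _ = ≢-nonZero p≢0

x≡x+x⇒x≡0 : ∀ (x : ℚ) → x ≡ x + x → x ≡ 0ℚ
x≡x+x⇒x≡0 x eq = begin
  x            ≡⟨ solve 1 (λ y → y := (y :+ y) :- y) refl x ⟩
  (x + x) - x  ≡⟨ cong (_- x) eq ⟨
  x - x        ≡⟨ ℚ.+-inverseʳ x ⟩
  0ℚ           ∎

x+x≡0⇒x≡0 : ∀ (x : ℚ) → x + x ≡ 0ℚ → x ≡ 0ℚ
x+x≡0⇒x≡0 x eq = begin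
  x                 ≡⟨ solve 1 (λ y → y := (y :+ y) :* :con ½) refl x ⟩
  (x + x) * ½       ≡⟨ cong (_* ½) eq ⟩
  0ℚ * ½            ≡⟨ ℚ.*-zeroˡ ½ ⟩
  0ℚ                ∎

x≡-x⇒x≡0 : ∀ (x : ℚ) → x ≡ - x → x ≡ 0ℚ
x≡-x⇒x≡0 x eq = x+x≡0⇒x≡0 x (trans (cong (_+_ x) eq) (ℚ.+-inverseʳ x))

private
  variable
    A C : Set

sumℚ : (A → ℚ) → List A → ℚ
sumℚ f = foldr (λ x s → f x + s) 0ℚ

sumℚ-cong : ∀ {f g : A → ℚ} → (∀ x → f x ≡ g x) → ∀ xs → sumℚ f xs ≡ sumℚ g xs
sumℚ-cong f≗g []       = refl
sumℚ-cong f≗g (x ∷ xs) = cong₂ _+_ (f≗g x) (sumℚ-cong f≗g xs)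

sumℚ-cong-∈ : ∀ {f g : A → ℚ} xs → (∀ {x} → x ∈ xs → f x ≡ g x) → sumℚ f xs ≡ sumℚ g xs
sumℚ-cong-∈ []       f≗g = refl
sumℚ-cong-∈ (x ∷ xs) f≗g = cong₂ _+_ (f≗g (here refl)) (sumℚ-cong-∈ xs (f≗g ∘ there))

sumℚ-++ : ∀ (f : A → ℚ) xs ys → sumℚ f (xs ++ ys) ≡ sumℚ f xs + sumℚ f ys
sumℚ-++ f []       ys = sym (ℚ.+-identityˡ _)
sumℚ-++ f (x ∷ xs) ys = trans (cong (_+_ (f x)) (sumℚ-++ f xs ys)) (sym (ℚ.+-assoc (f x) _ _))

sumℚ-*ˡ : ∀ c (f : A → ℚ) xs → c * sumℚ f xs ≡ sumℚ (λ x → c * f x) xs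
sumℚ-*ˡ c f []       = ℚ.*-zeroʳ c
sumℚ-*ˡ c f (x ∷ xs) = trans (ℚ.*-distribˡ-+ c (f x) _) (cong (_+_ (c * f x)) (sumℚ-*ˡ c f xs))

sumℚ-+ : ∀ (f g : A → ℚ) xs → sumℚ (λ x → f x + g x) xs ≡ sumℚ f xs + sumℚ g xs
sumℚ-+ f g []       = refl
sumℚ-+ f g (x ∷ xs) = trans (cong (_+_ (f x + g x)) (sumℚ-+ f g xs))
  (interchange (f x) (g x) (sumℚ f xs) (sumℚ g xs))

sumℚ-neg : ∀ (f : A → ℚ) xs → sumℚ (λ x → - f x) xs ≡ - sumℚ f xs
sumℚ-neg f []       = refl
sumℚ-neg f (x ∷ xs) = trans (cong (_+_ (- f x)) (sumℚ-neg f xs)) (sym (ℚ.neg-distrib-+ (f x) _))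

sumℚ-map : ∀ (f : C → ℚ) (g : A → C) xs → sumℚ f (map g xs) ≡ sumℚ (f ∘ g) xs
sumℚ-map f g []       = refl
sumℚ-map f g (x ∷ xs) = cong (_+_ (f (g x))) (sumℚ-map f g xs)

sumℚ-concatMap : ∀ (f : C → ℚ) (g : A → List C) xs →
                 sumℚ f (concatMap g xs) ≡ sumℚ (sumℚ f ∘ g) xs
sumℚ-concatMap f g []       = refl
sumℚ-concatMap f g (x ∷ xs) =
  trans (sumℚ-++ f (g x) (concatMap g xs)) (cong (_+_ (sumℚ f (g x))) (sumℚ-concatMap f g xs))

module Rearrangement {A : Set} (_≟ᴬ_ : DecidableEquality A) where

  remove : A → List A → Maybe (List A)
  remove x []       = nothing
  remove x (y ∷ ys) = if does (x ≟ᴬ y) then just ys else Maybe.map (y ∷_) (remove x ys)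

  rearranges : List A → List A → Bool
  rearranges []       ys = null ys
  rearranges (x ∷ xs) ys = maybe′ (rearranges xs) false (remove x ys)

  sumℚ-remove : ∀ (f : A → ℚ) x ys zs → remove x ys ≡ just zs → sumℚ f ys ≡ f x + sumℚ f zs
  sumℚ-remove f x (y ∷ ys) zs eq with x ≟ᴬ y | remove x ys in eq′
  sumℚ-remove f x (y ∷ ys) .ys refl | yes refl | _ = refl
  sumℚ-remove f x (y ∷ ys) .(y ∷ zs) refl | no _ | just zs = begin
    f y + sumℚ f ys            ≡⟨ cong (_+_ (f y)) (sumℚ-remove f x ys zs eq′) ⟩
    f y + (f x + sumℚ f zs)    ≡⟨ x∙yz≈y∙xz (f y) (f x) (sumℚ f zs) ⟩
    f x + (f y + sumℚ f zs)    ∎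

  sumℚ-rearranges : ∀ (f : A → ℚ) xs ys → T (rearranges xs ys) → sumℚ f xs ≡ sumℚ f ys
  sumℚ-rearranges f []       []       _ = refl
  sumℚ-rearranges f (x ∷ xs) ys       r with remove x ys in eq
  ... | just zs = trans (cong (_+_ (f x)) (sumℚ-rearranges f xs zs r)) (sym (sumℚ-remove f x ys zs eq))

allJust : ∀ {n} {P : Fin n → Set} → (∀ i → Maybe (P i)) → Maybe (∀ i → P i)
allJust {ℕ.zero}  m = just λ ()
allJust {ℕ.suc n} m = Maybe.zipWith (λ p ps → λ { zero → p ; (suc i) → ps i }) (m zero) (allJust (m ∘ suc))

record Linear {X : Set} (Φ : (X → ℚ) → ℚ) : Set where
  field
    cong-pointwise : ∀ {β γ} → (∀ x → β x ≡ γ x) → Φ β ≡ Φ γ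
    +-homo         : ∀ β γ → Φ (λ x → β x + γ x) ≡ Φ β + Φ γ
    *-homo         : ∀ c β → Φ (λ x → c * β x) ≡ c * Φ β

  0-homo : Φ (λ _ → 0ℚ) ≡ 0ℚ
  0-homo = begin
    Φ (λ _ → 0ℚ)         ≡⟨ cong-pointwise (λ _ → ℚ.*-zeroˡ 0ℚ) ⟨
    Φ (λ _ → 0ℚ * 0ℚ)    ≡⟨ *-homo 0ℚ (λ _ → 0ℚ) ⟩
    0ℚ * Φ (λ _ → 0ℚ)    ≡⟨ ℚ.*-zeroˡ (Φ (λ _ → 0ℚ)) ⟩
    0ℚ                   ∎

  sumℚ-homo : ∀ {A : Set} (a : A → ℚ) (β : A → X → ℚ) σs →
              Φ (λ x → sumℚ (λ σ → a σ * β σ x) σs) ≡ sumℚ (λ σ → a σ * Φ (β σ)) σs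
  sumℚ-homo a β []       = 0-homo
  sumℚ-homo a β (σ ∷ σs) = begin
    Φ (λ x → a σ * β σ x + sumℚ (λ τ → a τ * β τ x) σs)              ≡⟨ +-homo _ _ ⟩
    Φ (λ x → a σ * β σ x) + Φ (λ x → sumℚ (λ τ → a τ * β τ x) σs)    ≡⟨ cong₂ _+_ (*-homo (a σ) (β σ)) (sumℚ-homo a β σs) ⟩
    a σ * Φ (β σ) + sumℚ (λ τ → a τ * Φ (β τ)) σs                    ∎

Linear-sumℚ : ∀ {A X : Set} (f : A → (X → ℚ) → ℚ) → (∀ a → Linear (f a)) →
              ∀ xs → Linear (λ β → sumℚ (λ a → f a β) xs)
Linear-sumℚ f lin xs = record
  { cong-pointwise = λ β≗γ → sumℚ-cong (λ a → Linear.cong-pointwise (lin a) β≗γ) xs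
  ; +-homo = λ β γ → trans (sumℚ-cong (λ a → Linear.+-homo (lin a) β γ) xs) (sumℚ-+ (λ a → f a β) (λ a → f a γ) xs)
  ; *-homo = λ c β → trans (sumℚ-cong (λ a → Linear.*-homo (lin a) c β) xs) (sym (sumℚ-*ˡ c (λ a → f a β) xs))
  }

evalP-cong : ∀ {ρ τ : Fin 5 → ℚ} → (∀ i → ρ i ≡ τ i) → ∀ p → evalP ρ p ≡ evalP τ p
evalP-cong eq (var i) = eq i
evalP-cong eq (con c) = refl
evalP-cong eq (p ⊕ q) = cong₂ _+_ (evalP-cong eq p) (evalP-cong eq q)
evalP-cong eq (p ⊖ q) = cong₂ _-_ (evalP-cong eq p) (evalP-cong eq q)
evalP-cong eq (p ⊛ q) = cong₂ _*_ (evalP-cong eq p) (evalP-cong eq q)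

evalP-renameP : ∀ ρ σ p → evalP ρ (renameP σ p) ≡ evalP (ρ ∘ σ) p
evalP-renameP ρ σ (var i) = refl
evalP-renameP ρ σ (con c) = refl
evalP-renameP ρ σ (p ⊕ q) = cong₂ _+_ (evalP-renameP ρ σ p) (evalP-renameP ρ σ q)
evalP-renameP ρ σ (p ⊖ q) = cong₂ _-_ (evalP-renameP ρ σ p) (evalP-renameP ρ σ q)
evalP-renameP ρ σ (p ⊛ q) = cong₂ _*_ (evalP-renameP ρ σ p) (evalP-renameP ρ σ q)

renameP-resp-≈ₚ : ∀ σ {p q} → p ≈ₚ q → renameP σ p ≈ₚ renameP σ q
renameP-resp-≈ₚ σ {p} {q} p≈q ρ = begin
  evalP ρ (renameP σ p)  ≡⟨ evalP-renameP ρ σ p ⟩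
  evalP (ρ ∘ σ) p        ≡⟨ p≈q (ρ ∘ σ) ⟩
  evalP (ρ ∘ σ) q        ≡⟨ evalP-renameP ρ σ q ⟨
  evalP ρ (renameP σ q)  ∎

renameP-∘ : ∀ σ τ p → renameP σ (renameP τ p) ≈ₚ renameP (σ ∘ τ) p
renameP-∘ σ τ p ρ = begin
  evalP ρ (renameP σ (renameP τ p))  ≡⟨ evalP-renameP ρ σ (renameP τ p) ⟩
  evalP (ρ ∘ σ) (renameP τ p)        ≡⟨ evalP-renameP (ρ ∘ σ) τ p ⟩
  evalP (ρ ∘ σ ∘ τ) p                ≡⟨ evalP-renameP ρ (σ ∘ τ) p ⟨
  evalP ρ (renameP (σ ∘ τ) p)        ∎

renameP-resp-NonZeroP : ∀ {σ τ : Fin 5 → Fin 5} → (∀ i → τ (σ i) ≡ i) →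
                        ∀ p → NonZeroP p → NonZeroP (renameP σ p)
renameP-resp-NonZeroP {σ} {τ} τ∘σ≗id p p≢0 σp≡0 = p≢0 λ ρ → begin
  evalP ρ p                      ≡⟨ evalP-cong (λ i → cong ρ (τ∘σ≗id i)) p ⟨
  evalP (ρ ∘ τ ∘ σ) p            ≡⟨ evalP-renameP (ρ ∘ τ) σ p ⟨
  evalP (ρ ∘ τ) (renameP σ p)    ≡⟨ σp≡0 (ρ ∘ τ) ⟩
  0ℚ                             ∎

NonZeroAt : (Fin 5 → ℚ) → Poly → Set
NonZeroAt ρ p = evalP ρ p ≢ 0ℚ

NonZeroAt⇒NonZeroP : ∀ ρ p → NonZeroAt ρ p → NonZeroP p
NonZeroAt⇒NonZeroP ρ p p≢0 p≡0 = p≢0 (p≡0 ρ)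

NonZeroAt-⊛ : ∀ {ρ p q} → NonZeroAt ρ p → NonZeroAt ρ q → NonZeroAt ρ (p ⊛ q)
NonZeroAt-⊛ = *-≢0

NonZeroAt-negP : ∀ {ρ p} → NonZeroAt ρ p → NonZeroAt ρ (negP p)
NonZeroAt-negP {ρ} {p} = NonZeroAt-⊛ {ρ} {con (- 1ℚ)} {p} (λ ())

NonZeroP-con : ∀ {c} → c ≢ 0ℚ → NonZeroP (con c)
NonZeroP-con {c} = NonZeroAt⇒NonZeroP (λ _ → 0ℚ) (con c)

module Normalisation = +-*-Solver

toPolynomial : Poly → Normalisation.Polynomial 5
toPolynomial (var i) = Normalisation.var i
toPolynomial (con c) = Normalisation.con c
toPolynomial (p ⊕ q) = toPolynomial p :+ toPolynomial q
toPolynomial (p ⊖ q) = toPolynomial p :- toPolynomial q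
toPolynomial (p ⊛ q) = toPolynomial p :* toPolynomial q

evalP-toPolynomial : ∀ ρ p → evalP ρ p ≡ Normalisation.⟦ toPolynomial p ⟧ (Vec.tabulate ρ)
evalP-toPolynomial ρ (var i) = sym (Vecₚ.lookup∘tabulate ρ i)
evalP-toPolynomial ρ (con c) = refl
evalP-toPolynomial ρ (p ⊕ q) = cong₂ _+_ (evalP-toPolynomial ρ p) (evalP-toPolynomial ρ q)
evalP-toPolynomial ρ (p ⊖ q) = cong₂ _-_ (evalP-toPolynomial ρ p) (evalP-toPolynomial ρ q)
evalP-toPolynomial ρ (p ⊛ q) = cong₂ _*_ (evalP-toPolynomial ρ p) (evalP-toPolynomial ρ q)

_≈ₚ?_ : (p q : Poly) → Maybe (p ≈ₚ q)
p ≈ₚ? q = Maybe.map sound (normal p Normalisation.≟N normal q)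
  where
  open Normalisation using (⟦_⟧; ⟦_⟧↓; ⟦_⟧N-cong; correct; _≈N_; Normal)
  normal : Poly → Normal 5
  normal r = Normalisation.normalise (toPolynomial r)
  sound : normal p ≈N normal q → p ≈ₚ q
  sound p≈q ρ = begin
    evalP ρ p                       ≡⟨ evalP-toPolynomial ρ p ⟩
    ⟦ toPolynomial p ⟧ (Vec.tabulate ρ)   ≡⟨ correct (toPolynomial p) (Vec.tabulate ρ) ⟨
    ⟦ toPolynomial p ⟧↓ (Vec.tabulate ρ)  ≡⟨ ⟦ p≈q ⟧N-cong (Vec.tabulate ρ) ⟩
    ⟦ toPolynomial q ⟧↓ (Vec.tabulate ρ)  ≡⟨ correct (toPolynomial q) (Vec.tabulate ρ) ⟩
    ⟦ toPolynomial q ⟧ (Vec.tabulate ρ)   ≡⟨ evalP-toPolynomial ρ q ⟨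
    evalP ρ q                       ∎

infix 4 _∼_ _∼?_

_∼_ : Poly → Poly → Set
p ∼ q = p ≈ₚ q ⊎ p ≈ₚ negP q

_∼?_ : (p q : Poly) → Maybe (p ∼ q)
p ∼? q = Maybe.map inj₁ (p ≈ₚ? q) <∣> Maybe.map inj₂ (p ≈ₚ? negP q)

∼-sym : ∀ p q → p ∼ q → q ∼ p
∼-sym p q (inj₁ p≈q)  = inj₁ (λ ρ → sym (p≈q ρ))
∼-sym p q (inj₂ p≈-q) = inj₂ λ ρ → begin
  evalP ρ q                      ≡⟨ solve 1 (λ x → x := :con (- 1ℚ) :* (:con (- 1ℚ) :* x)) refl (evalP ρ q) ⟩
  - 1ℚ * (- 1ℚ * evalP ρ q)      ≡⟨ cong (- 1ℚ *_) (p≈-q ρ) ⟨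
  - 1ℚ * evalP ρ p               ∎

≈ₚ-∼-trans : ∀ p q r → p ≈ₚ q → q ∼ r → p ∼ r
≈ₚ-∼-trans p q r p≈q (inj₁ q≈r)  = inj₁ (λ ρ → trans (p≈q ρ) (q≈r ρ))
≈ₚ-∼-trans p q r p≈q (inj₂ q≈-r) = inj₂ (λ ρ → trans (p≈q ρ) (q≈-r ρ))

NonZeroAt-∼ : ∀ ρ p q → p ∼ q → NonZeroAt ρ q → NonZeroAt ρ p
NonZeroAt-∼ ρ p q (inj₁ p≈q)  q≢0 p≡0 = q≢0 (trans (sym (p≈q ρ)) p≡0)
NonZeroAt-∼ ρ p q (inj₂ p≈-q) q≢0 p≡0 = NonZeroAt-negP {ρ} {q} q≢0 (trans (sym (p≈-q ρ)) p≡0)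

NonZeroP-∼ : ∀ p q → p ∼ q → NonZeroP q → NonZeroP p
NonZeroP-∼ p q p∼q q≢0 p≡0 = q≢0 (q≡0 (∼-sym p q p∼q))
  where
  q≡0 : q ∼ p → q ≈ₚ con 0ℚ
  q≡0 (inj₁ q≈p)  ρ = trans (q≈p ρ) (p≡0 ρ)
  q≡0 (inj₂ q≈-p) ρ = trans (q≈-p ρ) (trans (cong (- 1ℚ *_) (p≡0 ρ)) (ℚ.*-zeroʳ (- 1ℚ)))

renameP-resp-∼ : ∀ σ {p q} → p ∼ q → renameP σ p ∼ renameP σ q
renameP-resp-∼ σ {p} {q} (inj₁ p≈q)  = inj₁ (renameP-resp-≈ₚ σ {p} {q} p≈q)
renameP-resp-∼ σ {p} {q} (inj₂ p≈-q) = inj₂ (renameP-resp-≈ₚ σ {p} {negP q} p≈-q)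

_/1 : Poly → RF
p /1 = p // con 1ℚ

NonZeroᵛ : ∀ {k} → Vec RF k → Set
NonZeroᵛ v = ∀ j → NonZeroR (lookupV v j)

NonZeroR-/1 : ∀ p → NonZeroP p → NonZeroR (p /1)
NonZeroR-/1 p p≢0 = p≢0 , NonZeroP-con (λ ())

module Slot {B : Vec RF 5 → ℚ} (ML : Multilinear B)
            (w : Vec RF 5) (i : Fin 5) (w≢0 : NonZeroᵛ w) where
  open Multilinear ML

  B[_] : RF → ℚ
  B[ f ] = B (w [ i ]≔ f)

  B[-]-resp-≈ₚ : ∀ p q → NonZeroP p → NonZeroP q → p ≈ₚ q → B[ p /1 ] ≡ B[ q /1 ]
  B[-]-resp-≈ₚ p q p≢0 q≢0 p≈q =
    resp w i (p /1) (q /1) w≢0 (NonZeroR-/1 p p≢0) (NonZeroR-/1 q q≢0) (λ ρ → cong (_* 1ℚ) (p≈q ρ))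

  B[⊛] : ∀ p q → NonZeroP p → NonZeroP q → NonZeroP (p ⊛ q) →
         B[ (p ⊛ q) /1 ] ≡ B[ p /1 ] + B[ q /1 ]
  B[⊛] p q p≢0 q≢0 pq≢0 = begin
    B[ (p ⊛ q) /1 ]              ≡⟨ resp w i _ _ w≢0 (NonZeroR-/1 (p ⊛ q) pq≢0) (pq≢0 , NonZeroP-con (λ ())) pq≈ ⟩
    B[ (p /1) ·ᵣ (q /1) ]        ≡⟨ mult w i (p /1) (q /1) w≢0 (NonZeroR-/1 p p≢0) (NonZeroR-/1 q q≢0) ⟩
    B[ p /1 ] + B[ q /1 ]        ∎
    where
    pq≈ : ((p ⊛ q) /1) ≈ᵣ ((p /1) ·ᵣ (q /1))
    pq≈ ρ = solve 2 (λ x y → (x :* y) :* (:con 1ℚ :* :con 1ℚ) := (x :* y) :* :con 1ℚ)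
                    refl (evalP ρ p) (evalP ρ q)

  B[1]≡0 : B[ con 1ℚ /1 ] ≡ 0ℚ
  B[1]≡0 = x≡x+x⇒x≡0 _ (begin
    B[ con 1ℚ /1 ]                   ≡⟨ B[-]-resp-≈ₚ (con 1ℚ) (con 1ℚ ⊛ con 1ℚ) 1≢0 1·1≢0 (λ _ → refl) ⟩
    B[ (con 1ℚ ⊛ con 1ℚ) /1 ]        ≡⟨ B[⊛] (con 1ℚ) (con 1ℚ) 1≢0 1≢0 1·1≢0 ⟩
    B[ con 1ℚ /1 ] + B[ con 1ℚ /1 ]  ∎)
    where
    1≢0 : NonZeroP (con 1ℚ)
    1≢0 = NonZeroP-con (λ ())
    1·1≢0 : NonZeroP (con 1ℚ ⊛ con 1ℚ)
    1·1≢0 = NonZeroAt⇒NonZeroP (λ _ → 0ℚ) (con 1ℚ ⊛ con 1ℚ) (λ ())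

  B[-1]≡0 : B[ con (- 1ℚ) /1 ] ≡ 0ℚ
  B[-1]≡0 = x+x≡0⇒x≡0 _ (begin
    B[ con (- 1ℚ) /1 ] + B[ con (- 1ℚ) /1 ]   ≡⟨ B[⊛] (con (- 1ℚ)) (con (- 1ℚ)) -1≢0 -1≢0 1≢0 ⟨
    B[ (con (- 1ℚ) ⊛ con (- 1ℚ)) /1 ]         ≡⟨ B[-]-resp-≈ₚ (con (- 1ℚ) ⊛ con (- 1ℚ)) (con 1ℚ) 1≢0 (NonZeroP-con (λ ())) (λ _ → refl) ⟩
    B[ con 1ℚ /1 ]                            ≡⟨ B[1]≡0 ⟩
    0ℚ                                        ∎)
    where
    -1≢0 : NonZeroP (con (- 1ℚ))
    -1≢0 = NonZeroP-con (λ ())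
    1≢0 : NonZeroP (con (- 1ℚ) ⊛ con (- 1ℚ))
    1≢0 = NonZeroAt⇒NonZeroP (λ _ → 0ℚ) (con (- 1ℚ) ⊛ con (- 1ℚ)) (λ ())

  B[negP] : ∀ p → NonZeroP p → B[ negP p /1 ] ≡ B[ p /1 ]
  B[negP] p p≢0 = begin
    B[ negP p /1 ]                     ≡⟨ B[⊛] (con (- 1ℚ)) p (NonZeroP-con (λ ())) p≢0 -p≢0 ⟩
    B[ con (- 1ℚ) /1 ] + B[ p /1 ]     ≡⟨ cong (_+ B[ p /1 ]) B[-1]≡0 ⟩
    0ℚ + B[ p /1 ]                     ≡⟨ ℚ.+-identityˡ _ ⟩
    B[ p /1 ]                          ∎
    where
    -p≢0 : NonZeroP (negP p)
    -p≢0 -p≡0 = p≢0 λ ρ → begin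
      evalP ρ p                 ≡⟨ solve 1 (λ x → x := :con (- 1ℚ) :* (:con (- 1ℚ) :* x)) refl (evalP ρ p) ⟩
      - 1ℚ * evalP ρ (negP p)   ≡⟨ cong (- 1ℚ *_) (-p≡0 ρ) ⟩
      0ℚ                        ∎

  B[-]-resp-∼ : ∀ p q → NonZeroP p → NonZeroP q → p ∼ q → B[ p /1 ] ≡ B[ q /1 ]
  B[-]-resp-∼ p q p≢0 q≢0 (inj₁ p≈q)  = B[-]-resp-≈ₚ p q p≢0 q≢0 p≈q
  B[-]-resp-∼ p q p≢0 q≢0 (inj₂ p≈-q) = begin
    B[ p /1 ]       ≡⟨ B[-]-resp-≈ₚ p (negP q) p≢0 -q≢0 p≈-q ⟩
    B[ negP q /1 ]  ≡⟨ B[negP] q q≢0 ⟩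
    B[ q /1 ]       ∎
    where
    -q≢0 : NonZeroP (negP q)
    -q≢0 -q≡0 = p≢0 (λ ρ → trans (p≈-q ρ) (-q≡0 ρ))

  B[//] : ∀ p q → NonZeroP p → NonZeroP q → NonZeroP (p ⊛ q) →
          B[ p // q ] ≡ B[ p /1 ] - B[ q /1 ]
  B[//] p q p≢0 q≢0 pq≢0 = begin
    B[ p // q ]                                ≡⟨ solve 2 (λ x y → x := (x :+ y) :- y) refl B[ p // q ] B[ q /1 ] ⟩
    (B[ p // q ] + B[ q /1 ]) - B[ q /1 ]      ≡⟨ cong (_- B[ q /1 ]) (mult w i (p // q) (q /1) w≢0 (p≢0 , q≢0) (NonZeroR-/1 q q≢0)) ⟨
    B[ (p // q) ·ᵣ (q /1) ] - B[ q /1 ]        ≡⟨ cong (_- B[ q /1 ]) (resp w i _ (p /1) w≢0 (pq≢0 , q·1≢0) (NonZeroR-/1 p p≢0) cancel) ⟩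
    B[ p /1 ] - B[ q /1 ]                      ∎
    where
    q·1≢0 : NonZeroP (q ⊛ con 1ℚ)
    q·1≢0 q·1≡0 = q≢0 (λ ρ → trans (sym (ℚ.*-identityʳ (evalP ρ q))) (q·1≡0 ρ))
    cancel : ((p // q) ·ᵣ (q /1)) ≈ᵣ (p /1)
    cancel ρ = solve 2 (λ x y → (x :* y) :* :con 1ℚ := x :* (y :* :con 1ℚ)) refl (evalP ρ p) (evalP ρ q)

lookupV-map : ∀ {A C : Set} (f : A → C) {k} (v : Vec A k) j → lookupV (Vec.map f v) j ≡ f (lookupV v j)
lookupV-map f (x ∷ v) zero    = refl
lookupV-map f (x ∷ v) (suc j) = lookupV-map f v j

renameᵛ : (Fin 5 → Fin 5) → Vec RF 5 → Vec RF 5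
renameᵛ σ = Vec.map (renameR σ)

renameR-resp-NonZeroR : ∀ {σ τ : Fin 5 → Fin 5} → (∀ i → τ (σ i) ≡ i) →
                        ∀ f → NonZeroR f → NonZeroR (renameR σ f)
renameR-resp-NonZeroR {τ = τ} τ∘σ≗id f (num≢0 , den≢0) =
  renameP-resp-NonZeroP {τ = τ} τ∘σ≗id (num f) num≢0 , renameP-resp-NonZeroP {τ = τ} τ∘σ≗id (den f) den≢0

Multilinear-rename : ∀ {σ τ : Fin 5 → Fin 5} → (∀ i → τ (σ i) ≡ i) →
                     ∀ {B} → Multilinear B → Multilinear (B ∘ renameᵛ σ)
Multilinear-rename {σ} {τ} τ∘σ≗id {B} ML = record
  { resp = λ v i f g v≢0 f≢0 g≢0 f≈g → begin
      B (renameᵛ σ (v [ i ]≔ f))              ≡⟨ cong B (Vecₚ.map-[]≔ (renameR σ) v i) ⟩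
      B (renameᵛ σ v [ i ]≔ renameR σ f)      ≡⟨ resp (renameᵛ σ v) i _ _ (rename≢0ᵛ v v≢0) (rename≢0 f f≢0) (rename≢0 g g≢0)
                                                       (renameP-resp-≈ₚ σ {num f ⊛ den g} {num g ⊛ den f} f≈g) ⟩
      B (renameᵛ σ v [ i ]≔ renameR σ g)      ≡⟨ cong B (Vecₚ.map-[]≔ (renameR σ) v i) ⟨
      B (renameᵛ σ (v [ i ]≔ g))              ∎
  ; mult = λ v i f g v≢0 f≢0 g≢0 → begin
      B (renameᵛ σ (v [ i ]≔ (f ·ᵣ g)))                                  ≡⟨ cong B (Vecₚ.map-[]≔ (renameR σ) v i) ⟩
      B (renameᵛ σ v [ i ]≔ (renameR σ f ·ᵣ renameR σ g))                ≡⟨ mult (renameᵛ σ v) i _ _ (rename≢0ᵛ v v≢0) (rename≢0 f f≢0) (rename≢0 g g≢0) ⟩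
      B (renameᵛ σ v [ i ]≔ renameR σ f) + B (renameᵛ σ v [ i ]≔ renameR σ g)
        ≡⟨ cong₂ _+_ (cong B (Vecₚ.map-[]≔ (renameR σ) v i)) (cong B (Vecₚ.map-[]≔ (renameR σ) v i)) ⟨
      B (renameᵛ σ (v [ i ]≔ f)) + B (renameᵛ σ (v [ i ]≔ g))            ∎
  }
  where
  open Multilinear ML
  rename≢0 : ∀ f → NonZeroR f → NonZeroR (renameR σ f)
  rename≢0 = renameR-resp-NonZeroR {τ = τ} τ∘σ≗id
  rename≢0ᵛ : ∀ v → NonZeroᵛ v → NonZeroᵛ (renameᵛ σ v)
  rename≢0ᵛ v v≢0 j = subst NonZeroR (sym (lookupV-map (renameR σ) v j)) (rename≢0 (lookupV v j) (v≢0 j))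

B-resp-∼ : ∀ {B} → Multilinear B → ∀ (ps qs : Vec Poly 5) →
           (∀ j → NonZeroP (lookupV ps j)) → (∀ j → NonZeroP (lookupV qs j)) → (∀ j → lookupV ps j ∼ lookupV qs j) →
           B (Vec.map _/1 ps) ≡ B (Vec.map _/1 qs)
B-resp-∼ {B} ML ps@(p₀ ∷ p₁ ∷ p₂ ∷ p₃ ∷ p₄ ∷ []) qs@(q₀ ∷ q₁ ∷ q₂ ∷ q₃ ∷ q₄ ∷ []) p≢0 q≢0 p∼q = begin
  B (Vec.map _/1 (p₀ ∷ p₁ ∷ p₂ ∷ p₃ ∷ p₄ ∷ []))  ≡⟨ replace 0F (p₀ ∷ p₁ ∷ p₂ ∷ p₃ ∷ p₄ ∷ []) (p 0F) (p 1F) (p 2F) (p 3F) (p 4F) ⟩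
  B (Vec.map _/1 (q₀ ∷ p₁ ∷ p₂ ∷ p₃ ∷ p₄ ∷ []))  ≡⟨ replace 1F (q₀ ∷ p₁ ∷ p₂ ∷ p₃ ∷ p₄ ∷ []) (q 0F) (p 1F) (p 2F) (p 3F) (p 4F) ⟩
  B (Vec.map _/1 (q₀ ∷ q₁ ∷ p₂ ∷ p₃ ∷ p₄ ∷ []))  ≡⟨ replace 2F (q₀ ∷ q₁ ∷ p₂ ∷ p₃ ∷ p₄ ∷ []) (q 0F) (q 1F) (p 2F) (p 3F) (p 4F) ⟩
  B (Vec.map _/1 (q₀ ∷ q₁ ∷ q₂ ∷ p₃ ∷ p₄ ∷ []))  ≡⟨ replace 3F (q₀ ∷ q₁ ∷ q₂ ∷ p₃ ∷ p₄ ∷ []) (q 0F) (q 1F) (q 2F) (p 3F) (p 4F) ⟩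
  B (Vec.map _/1 (q₀ ∷ q₁ ∷ q₂ ∷ q₃ ∷ p₄ ∷ []))  ≡⟨ replace 4F (q₀ ∷ q₁ ∷ q₂ ∷ q₃ ∷ p₄ ∷ []) (q 0F) (q 1F) (q 2F) (q 3F) (p 4F) ⟩
  B (Vec.map _/1 (q₀ ∷ q₁ ∷ q₂ ∷ q₃ ∷ q₄ ∷ []))  ∎
  where
  0F 1F 2F 3F 4F : Fin 5
  0F = # 0
  1F = # 1
  2F = # 2
  3F = # 3
  4F = # 4
  p : ∀ j → NonZeroR (lookupV ps j /1)
  p j = NonZeroR-/1 (lookupV ps j) (p≢0 j)
  q : ∀ j → NonZeroR (lookupV qs j /1)
  q j = NonZeroR-/1 (lookupV qs j) (q≢0 j)
  replace : ∀ i (w : Vec Poly 5) → NonZeroR (lookupV (Vec.map _/1 w) 0F) → NonZeroR (lookupV (Vec.map _/1 w) 1F) →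
            NonZeroR (lookupV (Vec.map _/1 w) 2F) → NonZeroR (lookupV (Vec.map _/1 w) 3F) → NonZeroR (lookupV (Vec.map _/1 w) 4F) →
            B (Vec.map _/1 w [ i ]≔ (lookupV ps i /1)) ≡ B (Vec.map _/1 w [ i ]≔ (lookupV qs i /1))
  replace i w w₀ w₁ w₂ w₃ w₄ = Slot.B[-]-resp-∼ ML (Vec.map _/1 w) i w≢0 (lookupV ps i) (lookupV qs i) (p≢0 i) (q≢0 i) (p∼q i)
    where
    w≢0 : NonZeroᵛ (Vec.map _/1 w)
    w≢0 zero                         = w₀
    w≢0 (suc zero)                   = w₁
    w≢0 (suc (suc zero))             = w₂
    w≢0 (suc (suc (suc zero)))       = w₃
    w≢0 (suc (suc (suc (suc zero)))) = w₄

-- The symbol of an alternation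

evalT-++ : ∀ B (t u : Tensor 5) → evalT B (t ++ u) ≡ evalT B t + evalT B u
evalT-++ B []            u = sym (ℚ.+-identityˡ _)
evalT-++ B ((c , v) ∷ t) u = trans (cong (_+_ (c * B v)) (evalT-++ B t u)) (sym (ℚ.+-assoc (c * B v) _ _))

evalT-scaleT : ∀ B c (t : Tensor 5) → evalT B (scaleT c t) ≡ c * evalT B t
evalT-scaleT B c []            = sym (ℚ.*-zeroʳ c)
evalT-scaleT B c ((d , v) ∷ t) = begin
  (c * d) * B v + evalT B (scaleT c t)  ≡⟨ cong (_+_ ((c * d) * B v)) (evalT-scaleT B c t) ⟩
  (c * d) * B v + c * evalT B t         ≡⟨ solve 4 (λ c d b e → (c :* d) :* b :+ c :* e := c :* (d :* b :+ e)) refl c d (B v) (evalT B t) ⟩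
  c * (d * B v + evalT B t)             ∎

evalT-ΠT-++ : ∀ B (t u : Tensor 5) → evalT B (ΠT (t ++ u)) ≡ evalT B (ΠT t) + evalT B (ΠT u)
evalT-ΠT-++ B t u = trans (cong (evalT B) (Listₚ.concatMap-++ _ t u)) (evalT-++ B (ΠT t) (ΠT u))

evalT-ΠT-scaleT : ∀ B c (t : Tensor 5) → evalT B (ΠT (scaleT c t)) ≡ c * evalT B (ΠT t)
evalT-ΠT-scaleT B c []            = sym (ℚ.*-zeroʳ c)
evalT-ΠT-scaleT B c ((d , v) ∷ t) = begin
  evalT B (scaleT (c * d) (Π 4 v) ++ ΠT (scaleT c t))          ≡⟨ evalT-++ B (scaleT (c * d) (Π 4 v)) (ΠT (scaleT c t)) ⟩
  evalT B (scaleT (c * d) (Π 4 v)) + evalT B (ΠT (scaleT c t))  ≡⟨ cong₂ _+_ (evalT-scaleT B (c * d) (Π 4 v)) (evalT-ΠT-scaleT B c t) ⟩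
  (c * d) * evalT B (Π 4 v) + c * evalT B (ΠT t)
    ≡⟨ solve 4 (λ c d b e → (c :* d) :* b :+ c :* e := c :* (d :* b :+ e)) refl c d (evalT B (Π 4 v)) (evalT B (ΠT t)) ⟩
  c * (d * evalT B (Π 4 v) + evalT B (ΠT t))                    ≡⟨ cong (λ x → c * (x + evalT B (ΠT t))) (evalT-scaleT B d (Π 4 v)) ⟨
  c * (evalT B (scaleT d (Π 4 v)) + evalT B (ΠT t))             ≡⟨ cong (c *_) (evalT-++ B (scaleT d (Π 4 v)) (ΠT t)) ⟨
  c * evalT B (scaleT d (Π 4 v) ++ ΠT t)                        ∎

termValue : (Vec RF 5 → ℚ) → ℚ × PLog → ℚ
termValue B (c , φ) = c * evalT B (ΠT (SymbPL φ))

evalT-SymbSh : ∀ B F → evalT B (SymbSh F) ≡ (+ 5 / 1) * sumℚ (termValue B) F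
evalT-SymbSh B F = trans (evalT-scaleT B (+ 5 / 1) (ΠT (Symb F))) (cong ((+ 5 / 1) *_) (ΠT-Symb F))
  where
  ΠT-Symb : ∀ F → evalT B (ΠT (Symb F)) ≡ sumℚ (termValue B) F
  ΠT-Symb []            = refl
  ΠT-Symb ((c , φ) ∷ F) = trans (evalT-ΠT-++ B (scaleT c (SymbPL φ)) (Symb F))
                                (cong₂ _+_ (evalT-ΠT-scaleT B c (SymbPL φ)) (ΠT-Symb F))

evalT-ΠT-SymbPL-renamePL : ∀ B σ φ → evalT B (ΠT (SymbPL (renamePL σ φ))) ≡ evalT (B ∘ renameᵛ σ) (ΠT (SymbPL φ))
evalT-ΠT-SymbPL-renamePL B σ (S₃₂ z) = refl
evalT-ΠT-SymbPL-renamePL B σ (Li₅ z) = refl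

-- Stated for an arbitrary g because Alt5 F is the instance whose g is the
-- pattern lambda inside Alt5.
evalT-SymbSh-alternation : ∀ B F σs (g : Vec (Fin 5) 5 → ℚ × PLog → ℚ × PLog) →
  (∀ σ c φ → g σ (c , φ) ≡ (sgn σ * c , renamePL (lookupV σ) φ)) →
  evalT B (SymbSh (concatMap (λ σ → map (g σ) F) σs)) ≡
  sumℚ (λ σ → sgn σ * evalT (B ∘ renameᵛ (lookupV σ)) (SymbSh F)) σs
evalT-SymbSh-alternation B F σs g g≡ = begin
  evalT B (SymbSh (concatMap (λ σ → map (g σ) F) σs))
    ≡⟨ evalT-SymbSh B (concatMap (λ σ → map (g σ) F) σs) ⟩
  (+ 5 / 1) * sumℚ (termValue B) (concatMap (λ σ → map (g σ) F) σs)
    ≡⟨ cong ((+ 5 / 1) *_) (trans (sumℚ-concatMap (termValue B) (λ σ → map (g σ) F) σs) (sumℚ-cong alternand σs)) ⟩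
  (+ 5 / 1) * sumℚ (λ σ → sgn σ * sumℚ (termValue (Bσ σ)) F) σs
    ≡⟨ sumℚ-*ˡ (+ 5 / 1) (λ σ → sgn σ * sumℚ (termValue (Bσ σ)) F) σs ⟩
  sumℚ (λ σ → (+ 5 / 1) * (sgn σ * sumℚ (termValue (Bσ σ)) F)) σs
    ≡⟨ sumℚ-cong (λ σ → solve 3 (λ a b c → a :* (b :* c) := b :* (a :* c)) refl (+ 5 / 1) (sgn σ) (sumℚ (termValue (Bσ σ)) F)) σs ⟩
  sumℚ (λ σ → sgn σ * ((+ 5 / 1) * sumℚ (termValue (Bσ σ)) F)) σs
    ≡⟨ sumℚ-cong (λ σ → cong (sgn σ *_) (evalT-SymbSh (Bσ σ) F)) σs ⟨
  sumℚ (λ σ → sgn σ * evalT (Bσ σ) (SymbSh F)) σs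
    ∎
  where
  Bσ : Vec (Fin 5) 5 → Vec RF 5 → ℚ
  Bσ σ = B ∘ renameᵛ (lookupV σ)
  term : ∀ σ x → termValue B (g σ x) ≡ sgn σ * termValue (Bσ σ) x
  term σ (c , φ) = begin
    termValue B (g σ (c , φ))                                    ≡⟨ cong (termValue B) (g≡ σ c φ) ⟩
    (sgn σ * c) * evalT B (ΠT (SymbPL (renamePL (lookupV σ) φ)))    ≡⟨ cong ((sgn σ * c) *_) (evalT-ΠT-SymbPL-renamePL B (lookupV σ) φ) ⟩
    (sgn σ * c) * evalT (Bσ σ) (ΠT (SymbPL φ))                      ≡⟨ ℚ.*-assoc (sgn σ) c (evalT (Bσ σ) (ΠT (SymbPL φ))) ⟩
    sgn σ * termValue (Bσ σ) (c , φ)                             ∎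
  alternand : ∀ σ → sumℚ (termValue B) (map (g σ) F) ≡ sgn σ * sumℚ (termValue (Bσ σ)) F
  alternand σ = begin
    sumℚ (termValue B) (map (g σ) F)              ≡⟨ sumℚ-map (termValue B) (g σ) F ⟩
    sumℚ (termValue B ∘ g σ) F                    ≡⟨ sumℚ-cong (term σ) F ⟩
    sumℚ (λ x → sgn σ * termValue (Bσ σ) x) F     ≡⟨ sumℚ-*ˡ (sgn σ) (termValue (Bσ σ)) F ⟨
    sgn σ * sumℚ (termValue (Bσ σ)) F             ∎

evalT-SymbSh-Alt5 : ∀ B F → evalT B (SymbSh (Alt5 F)) ≡
                    sumℚ (λ σ → sgn σ * evalT (B ∘ renameᵛ (lookupV σ)) (SymbSh F)) perms5
evalT-SymbSh-Alt5 B F = evalT-SymbSh-alternation B F perms5 _ (λ σ c φ → refl)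

data Argument : Set where
  cr r₁ r₂ r₃ : Argument

argument : Argument → RF
argument cr = CR
argument r₁ = R₁
argument r₂ = R₂
argument r₃ = R₃

data Atom : Set where
  ⟨_⟩ ⟨1-_⟩ : Argument → Atom

⟦_⟧ₐ : Atom → RF
⟦ ⟨ z ⟩ ⟧ₐ   = argument z
⟦ ⟨1- z ⟩ ⟧ₐ = oneMinus (argument z)

AtomTensor : Set
AtomTensor = List (ℤ × Vec Atom 5)

⟦_⟧ᵀ : AtomTensor → Tensor 5
⟦ t ⟧ᵀ = map (λ { (c , v) → fromℤ c , Vec.map ⟦_⟧ₐ v }) t

-- N Π_N, whose coefficients are ±1 since
-- N Π_N(a) = (N-1) Π_{N-1}(a₁ ⊗ … ⊗ a_{N-1}) ⊗ a_N − (N-1) Π_{N-1}(a₂ ⊗ … ⊗ a_N) ⊗ a₁.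
Πℤ : ∀ {A : Set} n → Vec A (suc n) → List (ℤ × Vec A (suc n))
Πℤ zero    v = (+ 1 , v) ∷ []
Πℤ (suc n) v =
  map (λ { (c , u) → c , u ∷ʳ lastV v }) (Πℤ n (initV v)) ++
  map (λ { (c , u) → ℤ.- c , u ∷ʳ headV v }) (Πℤ n (tailV v))

S₃₂-symbol Li₅-symbol : Argument → Vec Atom 5
S₃₂-symbol z = ⟨1- z ⟩ ∷ ⟨1- z ⟩ ∷ ⟨ z ⟩ ∷ ⟨ z ⟩ ∷ ⟨ z ⟩ ∷ []
Li₅-symbol z = ⟨1- z ⟩ ∷ ⟨ z ⟩ ∷ ⟨ z ⟩ ∷ ⟨ z ⟩ ∷ ⟨ z ⟩ ∷ []

-- Symb F₀, with the sign of the symbol of Li₅ absorbed into the coefficients.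
F₀-symbol : AtomTensor
F₀-symbol = (+ 11 , S₃₂-symbol cr) ∷ (-[1+ 14 ] , Li₅-symbol r₁) ∷ (+ 9 , Li₅-symbol r₂) ∷ (-[1+ 0 ] , Li₅-symbol r₃) ∷ []

F₀-symbolSh : AtomTensor
F₀-symbolSh = concatMap (λ { (c , v) → map (λ { (d , u) → c ℤ.* d , u }) (Πℤ 4 v) }) F₀-symbol

SymbSh-F₀ : SymbSh F₀ ≡ ⟦ F₀-symbolSh ⟧ᵀ
SymbSh-F₀ = refl

module LetterTensors (Letter : Set) where

  LinComb : Set
  LinComb = List (ℤ × Letter)

  weighted : (Letter → ℚ) → ℤ × Letter → ℚ
  weighted V (n , l) = fromℤ n * V l

  ⟦_⟧ᴸ : LinComb → (Letter → ℚ) → ℚ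
  ⟦ e ⟧ᴸ V = sumℚ (weighted V) e

  Term : ℕ → Set
  Term k = ℤ × Vec LinComb k

  Linear-⟦⟧ᴸ : ∀ e → Linear ⟦ e ⟧ᴸ
  Linear-⟦⟧ᴸ e = Linear-sumℚ (λ nl V → weighted V nl) lin e
    where
    lin : ∀ nl → Linear (λ V → weighted V nl)
    lin (n , l) = record
      { cong-pointwise = λ V≗W → cong (fromℤ n *_) (V≗W l)
      ; +-homo = λ V W → ℚ.*-distribˡ-+ (fromℤ n) (V l) (W l)
      ; *-homo = λ c V → solve 3 (λ a c v → a :* (c :* v) := c :* (a :* v)) refl (fromℤ n) c (V l)
      }

  -- Opaque, so that conversion checking never multiplies out a multilinear
  -- evaluation of a large tensor.
  opaque
    ⟦_⟧ᴹ : ∀ {k} → Vec LinComb k → (Vec Letter k → ℚ) → ℚ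
    ⟦ []     ⟧ᴹ β = β []
    ⟦ e ∷ es ⟧ᴹ β = ⟦ e ⟧ᴸ (λ l → ⟦ es ⟧ᴹ (β ∘ (l ∷_)))

    ⟦[]⟧ᴹ : ∀ β → ⟦ [] ⟧ᴹ β ≡ β []
    ⟦[]⟧ᴹ β = refl

    ⟦∷⟧ᴹ : ∀ {k} e (es : Vec LinComb k) β → ⟦ e ∷ es ⟧ᴹ β ≡ ⟦ e ⟧ᴸ (λ l → ⟦ es ⟧ᴹ (β ∘ (l ∷_)))
    ⟦∷⟧ᴹ e es β = refl

    Linear-⟦⟧ᴹ : ∀ {k} (es : Vec LinComb k) → Linear ⟦ es ⟧ᴹ
    Linear-⟦⟧ᴹ [] = record { cong-pointwise = λ β≗γ → β≗γ [] ; +-homo = λ _ _ → refl ; *-homo = λ _ _ → refl }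
    Linear-⟦⟧ᴹ (e ∷ es) = record
      { cong-pointwise = λ β≗γ → Head.cong-pointwise (λ l → Tail.cong-pointwise (λ J → β≗γ (l ∷ J)))
      ; +-homo = λ β γ → trans (Head.cong-pointwise (λ l → Tail.+-homo (β ∘ (l ∷_)) (γ ∘ (l ∷_)))) (Head.+-homo _ _)
      ; *-homo = λ c β → trans (Head.cong-pointwise (λ l → Tail.*-homo c (β ∘ (l ∷_)))) (Head.*-homo c _)
      }
      where
      module Head = Linear (Linear-⟦⟧ᴸ e)
      module Tail = Linear (Linear-⟦⟧ᴹ es)

  ⟦_⟧ᵗ : ∀ {k} → Term k → (Vec Letter k → ℚ) → ℚ
  ⟦ c , es ⟧ᵗ β = fromℤ c * ⟦ es ⟧ᴹ β

  ⟦_⟧ˢ : ∀ {k} → List (Term k) → (Vec Letter k → ℚ) → ℚ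
  ⟦ ts ⟧ˢ β = sumℚ (λ t → ⟦ t ⟧ᵗ β) ts

  Linear-⟦⟧ˢ : ∀ {k} (ts : List (Term k)) → Linear ⟦ ts ⟧ˢ
  Linear-⟦⟧ˢ = Linear-sumℚ ⟦_⟧ᵗ lin
    where
    lin : ∀ t → Linear ⟦ t ⟧ᵗ
    lin (c , es) = record
      { cong-pointwise = λ β≗γ → cong (fromℤ c *_) (Slots.cong-pointwise β≗γ)
      ; +-homo = λ β γ → trans (cong (fromℤ c *_) (Slots.+-homo β γ)) (ℚ.*-distribˡ-+ (fromℤ c) _ _)
      ; *-homo = λ d β → trans (cong (fromℤ c *_) (Slots.*-homo d β))
                               (solve 3 (λ a d m → a :* (d :* m) := d :* (a :* m)) refl (fromℤ c) d (⟦ es ⟧ᴹ β))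
      }
      where module Slots = Linear (Linear-⟦⟧ᴹ es)

  renameᴸ : (Letter → Letter) → LinComb → LinComb
  renameᴸ h = map (map₂ h)

  ⟦renameᴸ⟧ : ∀ h e V → ⟦ renameᴸ h e ⟧ᴸ V ≡ ⟦ e ⟧ᴸ (V ∘ h)
  ⟦renameᴸ⟧ h e V = sumℚ-map (weighted V) (map₂ h) e

-- Vanishing on alternating functions

module Cancellation
  {Letter : Set} (_≟_ : DecidableEquality Letter) (rank : Letter → ℕ)
  {Gen : Set} (act : Gen → Letter → Letter) (act-involutive : ∀ g l → act g (act g l) ≡ l)
  where

  open LetterTensors Letter

  Word : Set
  Word = List Gen

  actʷ actʷ⁻¹ : Word → Letter → Letter
  actʷ   []      = id
  actʷ   (g ∷ w) = act g ∘ actʷ w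
  actʷ⁻¹ []      = id
  actʷ⁻¹ (g ∷ w) = actʷ⁻¹ w ∘ act g

  actʷ-actʷ⁻¹ : ∀ w l → actʷ w (actʷ⁻¹ w l) ≡ l
  actʷ-actʷ⁻¹ []      l = refl
  actʷ-actʷ⁻¹ (g ∷ w) l = trans (cong (act g) (actʷ-actʷ⁻¹ w (act g l))) (act-involutive g l)

  map-actʷ-actʷ⁻¹ : ∀ {k} w (J : Vec Letter k) → Vec.map (actʷ w) (Vec.map (actʷ⁻¹ w) J) ≡ J
  map-actʷ-actʷ⁻¹ w J = trans (sym (Vecₚ.map-∘ (actʷ w) (actʷ⁻¹ w) J))
                              (trans (Vecₚ.map-cong (actʷ-actʷ⁻¹ w) J) (Vecₚ.map-id J))

  sign : Word → ℤ
  sign []      = + 1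
  sign (g ∷ w) = ℤ.- sign w

  Alternating : ∀ {k} → List Word → (Vec Letter k → ℚ) → Set
  Alternating G β = ∀ {w} → w ∈ G → ∀ J → β (Vec.map (actʷ w) J) ≡ fromℤ (sign w) * β J

  Alternating-[]∷ : ∀ {k G} {β : Vec Letter k → ℚ} → Alternating G β → Alternating ([] ∷ G) β
  Alternating-[]∷ {β = β} alt (here refl) J = trans (cong β (Vecₚ.map-id J)) (sym (ℚ.*-identityˡ (β J)))
  Alternating-[]∷ alt (there w∈G) = alt w∈G

  Alternating-generators : ∀ {k} {β : Vec Letter k → ℚ} → (∀ g J → β (Vec.map (act g) J) ≡ - β J) →
                           ∀ G → Alternating G β
  Alternating-generators {β = β} β-anti G {w} _ J = alternating w J
    where
    alternating : ∀ w J → β (Vec.map (actʷ w) J) ≡ fromℤ (sign w) * β J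
    alternating []      J = trans (cong β (Vecₚ.map-id J)) (sym (ℚ.*-identityˡ (β J)))
    alternating (g ∷ w) J = begin
      β (Vec.map (act g ∘ actʷ w) J)             ≡⟨ cong β (Vecₚ.map-∘ (act g) (actʷ w) J) ⟩
      β (Vec.map (act g) (Vec.map (actʷ w) J))   ≡⟨ β-anti g (Vec.map (actʷ w) J) ⟩
      - β (Vec.map (actʷ w) J)                   ≡⟨ cong -_ (alternating w J) ⟩
      - (fromℤ (sign w) * β J)                   ≡⟨ ℚ.neg-distribˡ-* (fromℤ (sign w)) (β J) ⟩
      - fromℤ (sign w) * β J                     ≡⟨ cong (_* β J) (fromℤ-neg (sign w)) ⟨
      fromℤ (ℤ.- sign w) * β J                   ∎

  -- Sorting by rank makes equal linear combinations syntactically equal, so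
  -- that merge can add up the coefficients of equal terms.
  insertᴸ : ℤ × Letter → LinComb → LinComb
  insertᴸ x []       = x ∷ []
  insertᴸ x (y ∷ ys) = if rank (proj₂ x) <ᵇ rank (proj₂ y) then x ∷ y ∷ ys else y ∷ insertᴸ x ys

  ⟦insertᴸ⟧ : ∀ x ys V → ⟦ insertᴸ x ys ⟧ᴸ V ≡ ⟦ x ∷ ys ⟧ᴸ V
  ⟦insertᴸ⟧ x [] V = refl
  ⟦insertᴸ⟧ (n , l) ((m , r) ∷ ys) V with rank l <ᵇ rank r
  ... | true  = refl
  ... | false = begin
    fromℤ m * V r + ⟦ insertᴸ (n , l) ys ⟧ᴸ V    ≡⟨ cong (_+_ (fromℤ m * V r)) (⟦insertᴸ⟧ (n , l) ys V) ⟩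
    fromℤ m * V r + (fromℤ n * V l + ⟦ ys ⟧ᴸ V)  ≡⟨ x∙yz≈y∙xz (fromℤ m * V r) (fromℤ n * V l) (⟦ ys ⟧ᴸ V) ⟩
    fromℤ n * V l + (fromℤ m * V r + ⟦ ys ⟧ᴸ V)  ∎

  canonicalᴸ : (Letter → Letter) → LinComb → LinComb
  canonicalᴸ h e = foldr insertᴸ [] (renameᴸ h e)

  ⟦canonicalᴸ⟧ : ∀ h e V → ⟦ canonicalᴸ h e ⟧ᴸ V ≡ ⟦ e ⟧ᴸ (V ∘ h)
  ⟦canonicalᴸ⟧ h e V = trans (sorted (renameᴸ h e)) (⟦renameᴸ⟧ h e V)
    where
    sorted : ∀ e → ⟦ foldr insertᴸ [] e ⟧ᴸ V ≡ ⟦ e ⟧ᴸ V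
    sorted []      = refl
    sorted (x ∷ e) = trans (⟦insertᴸ⟧ x (foldr insertᴸ [] e) V) (cong (_+_ (fromℤ (proj₁ x) * V (proj₂ x))) (sorted e))

  renameᴹ : ∀ {k} → (Letter → Letter) → Vec LinComb k → Vec LinComb k
  renameᴹ h = Vec.map (canonicalᴸ h)

  ⟦renameᴹ⟧ : ∀ {k} h (es : Vec LinComb k) β → ⟦ renameᴹ h es ⟧ᴹ β ≡ ⟦ es ⟧ᴹ (β ∘ Vec.map h)
  ⟦renameᴹ⟧ h []       β = trans (⟦[]⟧ᴹ β) (sym (⟦[]⟧ᴹ (β ∘ Vec.map h)))
  ⟦renameᴹ⟧ h (e ∷ es) β = begin
    ⟦ canonicalᴸ h e ∷ renameᴹ h es ⟧ᴹ β                           ≡⟨ ⟦∷⟧ᴹ (canonicalᴸ h e) (renameᴹ h es) β ⟩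
    ⟦ canonicalᴸ h e ⟧ᴸ (λ l → ⟦ renameᴹ h es ⟧ᴹ (β ∘ (l ∷_)))    ≡⟨ ⟦canonicalᴸ⟧ h e _ ⟩
    ⟦ e ⟧ᴸ (λ l → ⟦ renameᴹ h es ⟧ᴹ (β ∘ (h l ∷_)))               ≡⟨ Linear.cong-pointwise (Linear-⟦⟧ᴸ e) (λ l → ⟦renameᴹ⟧ h es (β ∘ (h l ∷_))) ⟩
    ⟦ e ⟧ᴸ (λ l → ⟦ es ⟧ᴹ (β ∘ Vec.map h ∘ (l ∷_)))               ≡⟨ ⟦∷⟧ᴹ e es (β ∘ Vec.map h) ⟨
    ⟦ e ∷ es ⟧ᴹ (β ∘ Vec.map h)                                    ∎

  closerImage : Letter → Word → Word × Letter → Word × Letter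
  closerImage l w (w₀ , r₀) = if rank (actʷ⁻¹ w l) <ᵇ rank r₀ then (w , actʷ⁻¹ w l) else (w₀ , r₀)

  -- The image of least rank of l under the words of [] ∷ G, and a word giving it.
  canonical : List Word → Letter → Word × Letter
  canonical G l = foldr (closerImage l) ([] , l) G

  canonical-sound : ∀ G l → proj₁ (canonical G l) ∈ [] ∷ G × proj₂ (canonical G l) ≡ actʷ⁻¹ (proj₁ (canonical G l)) l
  canonical-sound []      l = here refl , refl
  canonical-sound (w ∷ G) l with canonical G l | canonical-sound G l
  ... | (w₀ , r₀) | (w₀∈ , r₀≡) with rank (actʷ⁻¹ w l) <ᵇ rank r₀
  ...   | true  = there (here refl) , refl
  ...   | false = weaken w₀∈ , r₀≡
    where
    weaken : w₀ ∈ [] ∷ G → w₀ ∈ [] ∷ w ∷ G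
    weaken (here eq)  = here eq
    weaken (there w₀∈G) = there (there w₀∈G)

  Groups : ℕ → Set
  Groups k = List (Letter × List (Term k))

  ⟦_⟧ᴳ : ∀ {k} → Groups k → (Vec Letter (suc k) → ℚ) → ℚ
  ⟦ gs ⟧ᴳ β = sumℚ (λ { (r , ts) → ⟦ ts ⟧ˢ (β ∘ (r ∷_)) }) gs

  insertGroup : ∀ {k} → Letter → Term k → Groups k → Groups k
  insertGroup r t []              = (r , t ∷ []) ∷ []
  insertGroup r t ((s , ts) ∷ gs) = if does (r ≟ s) then (s , t ∷ ts) ∷ gs else (s , ts) ∷ insertGroup r t gs

  ⟦insertGroup⟧ : ∀ {k} r (t : Term k) gs β → ⟦ insertGroup r t gs ⟧ᴳ β ≡ ⟦ t ⟧ᵗ (β ∘ (r ∷_)) + ⟦ gs ⟧ᴳ β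
  ⟦insertGroup⟧ r t [] β = cong (_+ 0ℚ) (ℚ.+-identityʳ (⟦ t ⟧ᵗ (β ∘ (r ∷_))))
  ⟦insertGroup⟧ r t ((s , ts) ∷ gs) β with r ≟ s
  ... | yes refl = ℚ.+-assoc (⟦ t ⟧ᵗ (β ∘ (r ∷_))) (⟦ ts ⟧ˢ (β ∘ (r ∷_))) (⟦ gs ⟧ᴳ β)
  ... | no _     = begin
    ⟦ ts ⟧ˢ (β ∘ (s ∷_)) + ⟦ insertGroup r t gs ⟧ᴳ β                ≡⟨ cong (_+_ (⟦ ts ⟧ˢ (β ∘ (s ∷_)))) (⟦insertGroup⟧ r t gs β) ⟩
    ⟦ ts ⟧ˢ (β ∘ (s ∷_)) + (⟦ t ⟧ᵗ (β ∘ (r ∷_)) + ⟦ gs ⟧ᴳ β)         ≡⟨ x∙yz≈y∙xz (⟦ ts ⟧ˢ (β ∘ (s ∷_))) (⟦ t ⟧ᵗ (β ∘ (r ∷_))) (⟦ gs ⟧ᴳ β) ⟩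
    ⟦ t ⟧ᵗ (β ∘ (r ∷_)) + (⟦ ts ⟧ˢ (β ∘ (s ∷_)) + ⟦ gs ⟧ᴳ β)         ∎

  -- The summand n·l of the first slot of c·(e ⊗ es) is moved to the orbit
  -- representative r = w⁻¹ l, which costs the sign of w.
  moveToCanonical : ∀ {k} → List Word → ℤ → Vec LinComb k → ℤ × Letter → Groups k → Groups k
  moveToCanonical G c es (n , l) = insertGroup r ((c ℤ.* n) ℤ.* sign w , renameᴹ (actʷ⁻¹ w) es)
    where
    w = proj₁ (canonical G l)
    r = proj₂ (canonical G l)

  ⟦moveToCanonical⟧ : ∀ {k} G c es n l gs (β : Vec Letter (suc k) → ℚ) → Alternating ([] ∷ G) β →
    ⟦ moveToCanonical G c es (n , l) gs ⟧ᴳ β ≡ fromℤ c * (fromℤ n * ⟦ es ⟧ᴹ (β ∘ (l ∷_))) + ⟦ gs ⟧ᴳ β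
  ⟦moveToCanonical⟧ G c es n l gs β alt = begin
    ⟦ insertGroup r (c ℤ.* n ℤ.* sign w , renameᴹ (actʷ⁻¹ w) es) gs ⟧ᴳ β
      ≡⟨ ⟦insertGroup⟧ r _ gs β ⟩
    fromℤ (c ℤ.* n ℤ.* sign w) * ⟦ renameᴹ (actʷ⁻¹ w) es ⟧ᴹ (β ∘ (r ∷_)) + ⟦ gs ⟧ᴳ β
      ≡⟨ cong₂ (λ x y → x * y + ⟦ gs ⟧ᴳ β) (trans (fromℤ-* (c ℤ.* n) (sign w)) (cong (_* fromℤ (sign w)) (fromℤ-* c n)))
                                          (⟦renameᴹ⟧ (actʷ⁻¹ w) es (β ∘ (r ∷_))) ⟩
    (fromℤ c * fromℤ n) * fromℤ (sign w) * M + ⟦ gs ⟧ᴳ β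
      ≡⟨ cong (_+ ⟦ gs ⟧ᴳ β) (solve 4 (λ c n s m → c :* n :* s :* m := c :* (n :* (s :* m))) refl (fromℤ c) (fromℤ n) (fromℤ (sign w)) M) ⟩
    fromℤ c * (fromℤ n * (fromℤ (sign w) * M)) + ⟦ gs ⟧ᴳ β
      ≡⟨ cong (λ x → fromℤ c * (fromℤ n * x) + ⟦ gs ⟧ᴳ β) first-slot ⟨
    fromℤ c * (fromℤ n * ⟦ es ⟧ᴹ (β ∘ (l ∷_))) + ⟦ gs ⟧ᴳ β
      ∎
    where
    w = proj₁ (canonical G l)
    r = proj₂ (canonical G l)
    M = ⟦ es ⟧ᴹ (β ∘ (r ∷_) ∘ Vec.map (actʷ⁻¹ w))
    module Mᵉ = Linear (Linear-⟦⟧ᴹ es)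
    move : ∀ J → β (l ∷ J) ≡ fromℤ (sign w) * β (r ∷ Vec.map (actʷ⁻¹ w) J)
    move J = begin
      β (l ∷ J)                                          ≡⟨ cong β (cong₂ _∷_ l≡ (sym (map-actʷ-actʷ⁻¹ w J))) ⟩
      β (Vec.map (actʷ w) (r ∷ Vec.map (actʷ⁻¹ w) J))   ≡⟨ alt (proj₁ (canonical-sound G l)) (r ∷ Vec.map (actʷ⁻¹ w) J) ⟩
      fromℤ (sign w) * β (r ∷ Vec.map (actʷ⁻¹ w) J)      ∎
      where
      l≡ : l ≡ actʷ w r
      l≡ = sym (trans (cong (actʷ w) (proj₂ (canonical-sound G l))) (actʷ-actʷ⁻¹ w l))
    first-slot : ⟦ es ⟧ᴹ (β ∘ (l ∷_)) ≡ fromℤ (sign w) * M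
    first-slot = trans (Mᵉ.cong-pointwise move) (Mᵉ.*-homo (fromℤ (sign w)) _)

  groupByFirst : ∀ {k} → List Word → List (Term (suc k)) → Groups k
  groupByFirst G = foldr (λ { (c , e ∷ es) gs → foldr (moveToCanonical G c es) gs e }) []

  ⟦groupByFirst⟧ : ∀ {k} G ts (β : Vec Letter (suc k) → ℚ) → Alternating G β → ⟦ groupByFirst G ts ⟧ᴳ β ≡ ⟦ ts ⟧ˢ β
  ⟦groupByFirst⟧ G []                 β alt = refl
  ⟦groupByFirst⟧ G ((c , e ∷ es) ∷ ts) β alt = begin
    ⟦ foldr (moveToCanonical G c es) (groupByFirst G ts) e ⟧ᴳ β   ≡⟨ split e ⟩
    fromℤ c * ⟦ e ⟧ᴸ V + ⟦ groupByFirst G ts ⟧ᴳ β                ≡⟨ cong₂ (λ x y → fromℤ c * x + y) (sym (⟦∷⟧ᴹ e es β)) (⟦groupByFirst⟧ G ts β alt) ⟩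
    fromℤ c * ⟦ e ∷ es ⟧ᴹ β + ⟦ ts ⟧ˢ β                           ∎
    where
    V : Letter → ℚ
    V l = ⟦ es ⟧ᴹ (β ∘ (l ∷_))
    split : ∀ e → ⟦ foldr (moveToCanonical G c es) (groupByFirst G ts) e ⟧ᴳ β ≡ fromℤ c * ⟦ e ⟧ᴸ V + ⟦ groupByFirst G ts ⟧ᴳ β
    split []            = sym (trans (cong (_+ ⟦ groupByFirst G ts ⟧ᴳ β) (ℚ.*-zeroʳ (fromℤ c))) (ℚ.+-identityˡ _))
    split ((n , l) ∷ e) = begin
      ⟦ moveToCanonical G c es (n , l) (foldr (moveToCanonical G c es) (groupByFirst G ts) e) ⟧ᴳ β
        ≡⟨ ⟦moveToCanonical⟧ G c es n l (foldr (moveToCanonical G c es) (groupByFirst G ts) e) β (Alternating-[]∷ alt) ⟩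
      fromℤ c * (fromℤ n * V l) + ⟦ foldr (moveToCanonical G c es) (groupByFirst G ts) e ⟧ᴳ β
        ≡⟨ cong (_+_ (fromℤ c * (fromℤ n * V l))) (split e) ⟩
      fromℤ c * (fromℤ n * V l) + (fromℤ c * ⟦ e ⟧ᴸ V + ⟦ groupByFirst G ts ⟧ᴳ β)
        ≡⟨ solve 4 (λ c x y g → c :* x :+ (c :* y :+ g) := c :* (x :+ y) :+ g) refl (fromℤ c) (fromℤ n * V l) (⟦ e ⟧ᴸ V) (⟦ groupByFirst G ts ⟧ᴳ β) ⟩
      fromℤ c * ⟦ (n , l) ∷ e ⟧ᴸ V + ⟦ groupByFirst G ts ⟧ᴳ β
        ∎

  _≟ᴹ_ : ∀ {k} → DecidableEquality (Vec LinComb k)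
  _≟ᴹ_ = Vecₚ.≡-dec (Listₚ.≡-dec (Productₚ.≡-dec ℤ._≟_ _≟_))

  insertTerm : ∀ {k} → Term k → List (Term k) → List (Term k)
  insertTerm t []                     = t ∷ []
  insertTerm (c , es) ((d , fs) ∷ ts) =
    if does (es ≟ᴹ fs) then (c ℤ.+ d , fs) ∷ ts else (d , fs) ∷ insertTerm (c , es) ts

  merge : ∀ {k} → List (Term k) → List (Term k)
  merge ts = filter (λ t → ¬? (proj₁ t ℤ.≟ + 0)) (foldr insertTerm [] ts)

  ⟦merge⟧ : ∀ {k} ts (β : Vec Letter k → ℚ) → ⟦ merge ts ⟧ˢ β ≡ ⟦ ts ⟧ˢ β
  ⟦merge⟧ ts β = trans (drop-zeros (foldr insertTerm [] ts)) (inserted ts)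
    where
    ⟦insertTerm⟧ : ∀ t ts → ⟦ insertTerm t ts ⟧ˢ β ≡ ⟦ t ⟧ᵗ β + ⟦ ts ⟧ˢ β
    ⟦insertTerm⟧ t [] = refl
    ⟦insertTerm⟧ (c , es) ((d , fs) ∷ ts) with es ≟ᴹ fs
    ... | yes refl = begin
      fromℤ (c ℤ.+ d) * ⟦ es ⟧ᴹ β + ⟦ ts ⟧ˢ β                   ≡⟨ cong (λ x → x * ⟦ es ⟧ᴹ β + ⟦ ts ⟧ˢ β) (fromℤ-+ c d) ⟩
      (fromℤ c + fromℤ d) * ⟦ es ⟧ᴹ β + ⟦ ts ⟧ˢ β               ≡⟨ solve 4 (λ c d m s → (c :+ d) :* m :+ s := c :* m :+ (d :* m :+ s)) refl (fromℤ c) (fromℤ d) (⟦ es ⟧ᴹ β) (⟦ ts ⟧ˢ β) ⟩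
      fromℤ c * ⟦ es ⟧ᴹ β + (fromℤ d * ⟦ es ⟧ᴹ β + ⟦ ts ⟧ˢ β)   ∎
    ... | no _ = begin
      ⟦ d , fs ⟧ᵗ β + ⟦ insertTerm (c , es) ts ⟧ˢ β        ≡⟨ cong (_+_ (⟦ d , fs ⟧ᵗ β)) (⟦insertTerm⟧ (c , es) ts) ⟩
      ⟦ d , fs ⟧ᵗ β + (⟦ c , es ⟧ᵗ β + ⟦ ts ⟧ˢ β)          ≡⟨ x∙yz≈y∙xz (⟦ d , fs ⟧ᵗ β) (⟦ c , es ⟧ᵗ β) (⟦ ts ⟧ˢ β) ⟩
      ⟦ c , es ⟧ᵗ β + (⟦ d , fs ⟧ᵗ β + ⟦ ts ⟧ˢ β)          ∎
    inserted : ∀ ts → ⟦ foldr insertTerm [] ts ⟧ˢ β ≡ ⟦ ts ⟧ˢ β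
    inserted []       = refl
    inserted (t ∷ ts) = trans (⟦insertTerm⟧ t (foldr insertTerm [] ts)) (cong (_+_ (⟦ t ⟧ᵗ β)) (inserted ts))
    drop-zeros : ∀ ts → ⟦ filter (λ t → ¬? (proj₁ t ℤ.≟ + 0)) ts ⟧ˢ β ≡ ⟦ ts ⟧ˢ β
    drop-zeros [] = refl
    drop-zeros ((c , es) ∷ ts) with c ℤ.≟ + 0
    ... | yes refl = trans (drop-zeros ts) (sym (trans (cong (_+ ⟦ ts ⟧ˢ β) (ℚ.*-zeroˡ (⟦ es ⟧ᴹ β))) (ℚ.+-identityˡ _)))
    ... | no _     = cong (_+_ (⟦ c , es ⟧ᵗ β)) (drop-zeros ts)

  stabilizer : Letter → List Word → List Word
  stabilizer r = filter (λ w → actʷ w r ≟ r)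

  Alternating-stabilizer : ∀ {k} G r (β : Vec Letter (suc k) → ℚ) → Alternating G β →
                           Alternating (stabilizer r G) (β ∘ (r ∷_))
  Alternating-stabilizer G r β alt w∈ J with ∈-filter⁻ (λ w → actʷ w r ≟ r) w∈
  ... | w∈G , wr≡r = trans (cong (λ x → β (x ∷ Vec.map _ J)) (sym wr≡r)) (alt w∈G (r ∷ J))

  isOdd : Word → Bool
  isOdd w = isYes (sign w ℤ.≟ -[1+ 0 ])

  -- At depth zero the terms are scalar multiples of β [], which vanishes if
  -- an odd word fixes everything; otherwise the merged scalars must cancel.
  vanishes : (k : ℕ) → List Word → List (Term k) → Bool
  vanishes zero    G ts = any isOdd G ∨ null ts
  vanishes (suc k) G ts = all (λ { (r , us) → vanishes k (stabilizer r G) (merge us) }) (groupByFirst G ts)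

  vanishes-sound : ∀ k G ts (β : Vec Letter k → ℚ) → vanishes k G ts ≡ true → Alternating G β → ⟦ ts ⟧ˢ β ≡ 0ℚ
  vanishes-sound zero G ts β t alt with Equivalence.to T-∨ (Equivalence.from T-≡ t)
  ... | inj₁ odd = trans (Linear.cong-pointwise (Linear-⟦⟧ˢ ts) β≡0) (Linear.0-homo (Linear-⟦⟧ˢ ts))
    where
    β≡0 : ∀ J → β J ≡ 0ℚ
    β≡0 [] with find (Anyₚ.any⁻ isOdd G odd)
    ... | w , w∈G , w-odd = x≡-x⇒x≡0 (β []) (trans (alt w∈G []) (begin
      fromℤ (sign w) * β []    ≡⟨ cong (λ s → fromℤ s * β []) (toWitness {a? = sign w ℤ.≟ -[1+ 0 ]} w-odd) ⟩
      - 1ℚ * β []              ≡⟨ solve 1 (λ x → :con (- 1ℚ) :* x := :- x) refl (β []) ⟩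
      - β []                   ∎))
  ... | inj₂ empty with ts
  ...   | [] = refl
  vanishes-sound (suc k) G ts β t alt = begin
    ⟦ ts ⟧ˢ β                    ≡⟨ ⟦groupByFirst⟧ G ts β alt ⟨
    ⟦ groupByFirst G ts ⟧ᴳ β     ≡⟨ groups (groupByFirst G ts) (Allₚ.all⁺ _ (groupByFirst G ts) (Equivalence.from T-≡ t)) ⟩
    0ℚ                           ∎
    where
    groups : ∀ gs → All (T ∘ λ { (r , us) → vanishes k (stabilizer r G) (merge us) }) gs → ⟦ gs ⟧ᴳ β ≡ 0ℚ
    groups [] [] = refl
    groups ((r , us) ∷ gs) (v ∷ vs) = begin
      ⟦ us ⟧ˢ (β ∘ (r ∷_)) + ⟦ gs ⟧ᴳ β              ≡⟨ cong (_+ ⟦ gs ⟧ᴳ β) (⟦merge⟧ us (β ∘ (r ∷_))) ⟨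
      ⟦ merge us ⟧ˢ (β ∘ (r ∷_)) + ⟦ gs ⟧ᴳ β        ≡⟨ cong₂ _+_ (vanishes-sound k (stabilizer r G) (merge us) (β ∘ (r ∷_)) (Equivalence.to T-≡ v)
                                                                     (Alternating-stabilizer G r β alt))
                                                                  (groups gs vs) ⟩
      0ℚ + 0ℚ                                        ∎

Letter : Set
Letter = Fin 45

cubicAt quarticAt : Vec (Fin 5) 5 → Poly
cubicAt π   = renameP (lookupV π) (den R₁ ⊖ num R₁)
quarticAt π = renameP (lookupV π) (den R₂ ⊖ num R₂)

-- The differences x_i − x_j (i < j), then the S₅-translates up to sign of the
-- numerators of 1 − R₁ (15 of them) and of 1 − R₂ (20 of them).
letterPolys : Vec Poly 45
letterPolys =
  x₁ ⊖ x₂ ∷ x₁ ⊖ x₃ ∷ x₁ ⊖ x₄ ∷ x₁ ⊖ x₅ ∷ x₂ ⊖ x₃ ∷ x₂ ⊖ x₄ ∷ x₂ ⊖ x₅ ∷ x₃ ⊖ x₄ ∷ x₃ ⊖ x₅ ∷ x₄ ⊖ x₅ ∷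
  cubicAt (# 0 ∷ # 1 ∷ # 2 ∷ # 3 ∷ # 4 ∷ []) ∷ cubicAt (# 0 ∷ # 1 ∷ # 3 ∷ # 2 ∷ # 4 ∷ []) ∷ cubicAt (# 0 ∷ # 1 ∷ # 4 ∷ # 2 ∷ # 3 ∷ []) ∷
  cubicAt (# 1 ∷ # 0 ∷ # 2 ∷ # 3 ∷ # 4 ∷ []) ∷ cubicAt (# 1 ∷ # 0 ∷ # 3 ∷ # 2 ∷ # 4 ∷ []) ∷ cubicAt (# 1 ∷ # 0 ∷ # 4 ∷ # 2 ∷ # 3 ∷ []) ∷
  cubicAt (# 2 ∷ # 0 ∷ # 1 ∷ # 3 ∷ # 4 ∷ []) ∷ cubicAt (# 2 ∷ # 0 ∷ # 3 ∷ # 1 ∷ # 4 ∷ []) ∷ cubicAt (# 2 ∷ # 0 ∷ # 4 ∷ # 1 ∷ # 3 ∷ []) ∷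
  cubicAt (# 3 ∷ # 0 ∷ # 1 ∷ # 2 ∷ # 4 ∷ []) ∷ cubicAt (# 3 ∷ # 0 ∷ # 2 ∷ # 1 ∷ # 4 ∷ []) ∷ cubicAt (# 3 ∷ # 0 ∷ # 4 ∷ # 1 ∷ # 2 ∷ []) ∷
  cubicAt (# 4 ∷ # 0 ∷ # 1 ∷ # 2 ∷ # 3 ∷ []) ∷ cubicAt (# 4 ∷ # 0 ∷ # 2 ∷ # 1 ∷ # 3 ∷ []) ∷ cubicAt (# 4 ∷ # 0 ∷ # 3 ∷ # 1 ∷ # 2 ∷ []) ∷
  quarticAt (# 0 ∷ # 1 ∷ # 2 ∷ # 3 ∷ # 4 ∷ []) ∷ quarticAt (# 0 ∷ # 1 ∷ # 2 ∷ # 4 ∷ # 3 ∷ []) ∷ quarticAt (# 0 ∷ # 1 ∷ # 3 ∷ # 2 ∷ # 4 ∷ []) ∷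
  quarticAt (# 0 ∷ # 1 ∷ # 3 ∷ # 4 ∷ # 2 ∷ []) ∷ quarticAt (# 0 ∷ # 1 ∷ # 4 ∷ # 2 ∷ # 3 ∷ []) ∷ quarticAt (# 0 ∷ # 1 ∷ # 4 ∷ # 3 ∷ # 2 ∷ []) ∷
  quarticAt (# 0 ∷ # 2 ∷ # 3 ∷ # 1 ∷ # 4 ∷ []) ∷ quarticAt (# 0 ∷ # 2 ∷ # 3 ∷ # 4 ∷ # 1 ∷ []) ∷ quarticAt (# 0 ∷ # 2 ∷ # 4 ∷ # 1 ∷ # 3 ∷ []) ∷
  quarticAt (# 0 ∷ # 2 ∷ # 4 ∷ # 3 ∷ # 1 ∷ []) ∷ quarticAt (# 0 ∷ # 3 ∷ # 4 ∷ # 1 ∷ # 2 ∷ []) ∷ quarticAt (# 0 ∷ # 3 ∷ # 4 ∷ # 2 ∷ # 1 ∷ []) ∷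
  quarticAt (# 1 ∷ # 2 ∷ # 3 ∷ # 0 ∷ # 4 ∷ []) ∷ quarticAt (# 1 ∷ # 2 ∷ # 3 ∷ # 4 ∷ # 0 ∷ []) ∷ quarticAt (# 1 ∷ # 2 ∷ # 4 ∷ # 0 ∷ # 3 ∷ []) ∷
  quarticAt (# 1 ∷ # 2 ∷ # 4 ∷ # 3 ∷ # 0 ∷ []) ∷ quarticAt (# 1 ∷ # 3 ∷ # 4 ∷ # 0 ∷ # 2 ∷ []) ∷ quarticAt (# 1 ∷ # 3 ∷ # 4 ∷ # 2 ∷ # 0 ∷ []) ∷
  quarticAt (# 2 ∷ # 3 ∷ # 4 ∷ # 0 ∷ # 1 ∷ []) ∷ quarticAt (# 2 ∷ # 3 ∷ # 4 ∷ # 1 ∷ # 0 ∷ []) ∷ []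

letterPoly : Letter → Poly
letterPoly = Vec.lookup letterPolys

transposition : Fin 4 → Vec (Fin 5) 5
transposition g = Vec.tabulate (transpose (inject₁ g) (suc g))

actionTable : Vec (Vec Letter 45) 4
actionTable =
  (# 0 ∷ # 4 ∷ # 5 ∷ # 6 ∷ # 1 ∷ # 2 ∷ # 3 ∷ # 7 ∷ # 8 ∷ # 9 ∷
   # 13 ∷ # 14 ∷ # 15 ∷ # 10 ∷ # 11 ∷ # 12 ∷ # 16 ∷ # 18 ∷ # 17 ∷ # 19 ∷ # 21 ∷ # 20 ∷ # 22 ∷ # 24 ∷ # 23 ∷
   # 26 ∷ # 25 ∷ # 28 ∷ # 27 ∷ # 30 ∷ # 29 ∷ # 37 ∷ # 38 ∷ # 39 ∷ # 40 ∷ # 41 ∷ # 42 ∷ # 31 ∷ # 32 ∷ # 33 ∷ # 34 ∷ # 35 ∷ # 36 ∷ # 44 ∷ # 43 ∷ []) ∷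
  (# 1 ∷ # 0 ∷ # 2 ∷ # 3 ∷ # 4 ∷ # 7 ∷ # 8 ∷ # 5 ∷ # 6 ∷ # 9 ∷
   # 10 ∷ # 12 ∷ # 11 ∷ # 16 ∷ # 17 ∷ # 18 ∷ # 13 ∷ # 14 ∷ # 15 ∷ # 20 ∷ # 19 ∷ # 21 ∷ # 23 ∷ # 22 ∷ # 24 ∷
   # 26 ∷ # 25 ∷ # 31 ∷ # 32 ∷ # 33 ∷ # 34 ∷ # 27 ∷ # 28 ∷ # 29 ∷ # 30 ∷ # 36 ∷ # 35 ∷ # 38 ∷ # 37 ∷ # 40 ∷ # 39 ∷ # 43 ∷ # 44 ∷ # 41 ∷ # 42 ∷ []) ∷
  (# 0 ∷ # 2 ∷ # 1 ∷ # 3 ∷ # 5 ∷ # 4 ∷ # 6 ∷ # 7 ∷ # 9 ∷ # 8 ∷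
   # 11 ∷ # 10 ∷ # 12 ∷ # 14 ∷ # 13 ∷ # 15 ∷ # 19 ∷ # 20 ∷ # 21 ∷ # 16 ∷ # 17 ∷ # 18 ∷ # 22 ∷ # 24 ∷ # 23 ∷
   # 27 ∷ # 28 ∷ # 25 ∷ # 26 ∷ # 30 ∷ # 29 ∷ # 32 ∷ # 31 ∷ # 35 ∷ # 36 ∷ # 33 ∷ # 34 ∷ # 38 ∷ # 37 ∷ # 41 ∷ # 42 ∷ # 39 ∷ # 40 ∷ # 44 ∷ # 43 ∷ []) ∷
  (# 0 ∷ # 1 ∷ # 3 ∷ # 2 ∷ # 4 ∷ # 6 ∷ # 5 ∷ # 8 ∷ # 7 ∷ # 9 ∷
   # 10 ∷ # 12 ∷ # 11 ∷ # 13 ∷ # 15 ∷ # 14 ∷ # 16 ∷ # 18 ∷ # 17 ∷ # 22 ∷ # 23 ∷ # 24 ∷ # 19 ∷ # 20 ∷ # 21 ∷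
   # 26 ∷ # 25 ∷ # 29 ∷ # 30 ∷ # 27 ∷ # 28 ∷ # 33 ∷ # 34 ∷ # 31 ∷ # 32 ∷ # 36 ∷ # 35 ∷ # 39 ∷ # 40 ∷ # 37 ∷ # 38 ∷ # 42 ∷ # 41 ∷ # 44 ∷ # 43 ∷ []) ∷ []

act : Fin 4 → Letter → Letter
act g = Vec.lookup (Vec.lookup actionTable g)

act-involutive : ∀ g l → act g (act g l) ≡ l
act-involutive = from-yes (all? λ g → all? λ l → act g (act g l) ≟ l)

act-letterPoly : ∀ g l → renameP (lookupV (transposition g)) (letterPoly l) ∼ letterPoly (act g l)
act-letterPoly = from-just (allJust λ g → allJust λ l → renameP (lookupV (transposition g)) (letterPoly l) ∼? letterPoly (act g l))

sample : Fin 5 → ℚ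
sample = Vec.lookup (+ 0 / 1 ∷ + 1 / 1 ∷ + 3 / 1 ∷ + 7 / 1 ∷ + 12 / 1 ∷ [])

letterPoly≢0 : ∀ l → NonZeroAt sample (letterPoly l)
letterPoly≢0 = from-yes (all? λ l → ¬? (evalP sample (letterPoly l) ℚ.≟ 0ℚ))

open LetterTensors Letter
open Cancellation _≟_ toℕ act act-involutive

-- Factorisation of the atoms into letters

δ₁₂ δ₁₃ δ₁₄ δ₁₅ δ₂₃ δ₂₄ δ₂₅ δ₃₄ δ₃₅ κ₁ κ₂ : Letter
δ₁₂ = # 0
δ₁₃ = # 1
δ₁₄ = # 2
δ₁₅ = # 3
δ₂₃ = # 4
δ₂₄ = # 5
δ₂₅ = # 6
δ₃₄ = # 7
δ₃₅ = # 8
κ₁  = # 10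
κ₂  = # 25

poles : Argument → List Letter
poles cr = δ₁₄ ∷ δ₂₃ ∷ []
poles r₁ = δ₁₃ ∷ δ₁₅ ∷ δ₂₄ ∷ []
poles r₂ = δ₁₃ ∷ δ₁₄ ∷ δ₂₃ ∷ δ₂₅ ∷ []
poles r₃ = δ₁₃ ∷ δ₁₃ ∷ δ₁₃ ∷ δ₁₄ ∷ δ₂₄ ∷ δ₂₅ ∷ δ₂₅ ∷ []

numeratorLetters denominatorLetters : Atom → List Letter
numeratorLetters ⟨ cr ⟩    = δ₁₃ ∷ δ₂₄ ∷ []
numeratorLetters ⟨1- cr ⟩  = δ₁₂ ∷ δ₃₄ ∷ []
numeratorLetters ⟨ r₁ ⟩    = δ₁₂ ∷ δ₁₄ ∷ δ₃₅ ∷ []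
numeratorLetters ⟨1- r₁ ⟩  = κ₁ ∷ []
numeratorLetters ⟨ r₂ ⟩    = δ₁₂ ∷ δ₁₂ ∷ δ₃₄ ∷ δ₃₅ ∷ []
numeratorLetters ⟨1- r₂ ⟩  = κ₂ ∷ []
numeratorLetters ⟨ r₃ ⟩    = δ₁₂ ∷ δ₁₂ ∷ δ₁₂ ∷ δ₁₅ ∷ δ₃₄ ∷ δ₃₄ ∷ δ₃₅ ∷ []
numeratorLetters ⟨1- r₃ ⟩  = κ₁ ∷ κ₂ ∷ []
denominatorLetters ⟨ z ⟩   = poles z
denominatorLetters ⟨1- z ⟩ = poles z

∏ : List Letter → Poly
∏ = foldr (λ l p → letterPoly l ⊛ p) (con 1ℚ)

record Factorisation (a : Atom) : Set where
  field
    numerator   : num ⟦ a ⟧ₐ ∼ ∏ (numeratorLetters a)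
    denominator : den ⟦ a ⟧ₐ ∼ ∏ (denominatorLetters a)

factorisation? : ∀ a → Maybe (Factorisation a)
factorisation? a = Maybe.zipWith (λ n d → record { numerator = n ; denominator = d })
  (num ⟦ a ⟧ₐ ∼? ∏ (numeratorLetters a)) (den ⟦ a ⟧ₐ ∼? ∏ (denominatorLetters a))

factorisation : ∀ a → Factorisation a
factorisation ⟨ cr ⟩   = from-just (factorisation? ⟨ cr ⟩)
factorisation ⟨1- cr ⟩ = from-just (factorisation? ⟨1- cr ⟩)
factorisation ⟨ r₁ ⟩   = from-just (factorisation? ⟨ r₁ ⟩)
factorisation ⟨1- r₁ ⟩ = from-just (factorisation? ⟨1- r₁ ⟩)
factorisation ⟨ r₂ ⟩   = from-just (factorisation? ⟨ r₂ ⟩)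
factorisation ⟨1- r₂ ⟩ = from-just (factorisation? ⟨1- r₂ ⟩)
factorisation ⟨ r₃ ⟩   = from-just (factorisation? ⟨ r₃ ⟩)
factorisation ⟨1- r₃ ⟩ = from-just (factorisation? ⟨1- r₃ ⟩)

addLetter : ℤ → Letter → LinComb → LinComb
addLetter n l []            = (n , l) ∷ []
addLetter n l ((m , r) ∷ e) = if does (l ≟ r) then (n ℤ.+ m , r) ∷ e else (m , r) ∷ addLetter n l e

⟦addLetter⟧ : ∀ n l e V → ⟦ addLetter n l e ⟧ᴸ V ≡ fromℤ n * V l + ⟦ e ⟧ᴸ V
⟦addLetter⟧ n l []            V = refl
⟦addLetter⟧ n l ((m , r) ∷ e) V with l ≟ r
... | yes refl = begin
  fromℤ (n ℤ.+ m) * V l + ⟦ e ⟧ᴸ V                  ≡⟨ cong (λ x → x * V l + ⟦ e ⟧ᴸ V) (fromℤ-+ n m) ⟩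
  (fromℤ n + fromℤ m) * V l + ⟦ e ⟧ᴸ V              ≡⟨ solve 4 (λ n m v s → (n :+ m) :* v :+ s := n :* v :+ (m :* v :+ s)) refl (fromℤ n) (fromℤ m) (V l) (⟦ e ⟧ᴸ V) ⟩
  fromℤ n * V l + (fromℤ m * V l + ⟦ e ⟧ᴸ V)        ∎
... | no _ = begin
  fromℤ m * V r + ⟦ addLetter n l e ⟧ᴸ V            ≡⟨ cong (_+_ (fromℤ m * V r)) (⟦addLetter⟧ n l e V) ⟩
  fromℤ m * V r + (fromℤ n * V l + ⟦ e ⟧ᴸ V)        ≡⟨ x∙yz≈y∙xz (fromℤ m * V r) (fromℤ n * V l) (⟦ e ⟧ᴸ V) ⟩
  fromℤ n * V l + (fromℤ m * V r + ⟦ e ⟧ᴸ V)        ∎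

⟦addLetters⟧ : ∀ n ls e V → ⟦ foldr (addLetter n) e ls ⟧ᴸ V ≡ fromℤ n * sumℚ V ls + ⟦ e ⟧ᴸ V
⟦addLetters⟧ n []       e V = sym (trans (cong (_+ ⟦ e ⟧ᴸ V) (ℚ.*-zeroʳ (fromℤ n))) (ℚ.+-identityˡ (⟦ e ⟧ᴸ V)))
⟦addLetters⟧ n (l ∷ ls) e V = begin
  ⟦ addLetter n l (foldr (addLetter n) e ls) ⟧ᴸ V       ≡⟨ ⟦addLetter⟧ n l (foldr (addLetter n) e ls) V ⟩
  fromℤ n * V l + ⟦ foldr (addLetter n) e ls ⟧ᴸ V       ≡⟨ cong (_+_ (fromℤ n * V l)) (⟦addLetters⟧ n ls e V) ⟩
  fromℤ n * V l + (fromℤ n * sumℚ V ls + ⟦ e ⟧ᴸ V)      ≡⟨ solve 4 (λ n v s e → n :* v :+ (n :* s :+ e) := n :* (v :+ s) :+ e) refl (fromℤ n) (V l) (sumℚ V ls) (⟦ e ⟧ᴸ V) ⟩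
  fromℤ n * (V l + sumℚ V ls) + ⟦ e ⟧ᴸ V                ∎

divisor : Atom → LinComb
divisor a = foldr (addLetter (+ 1)) (foldr (addLetter -[1+ 0 ]) [] (denominatorLetters a)) (numeratorLetters a)

⟦divisor⟧ : ∀ a V → ⟦ divisor a ⟧ᴸ V ≡ sumℚ V (numeratorLetters a) - sumℚ V (denominatorLetters a)
⟦divisor⟧ a V = begin
  ⟦ divisor a ⟧ᴸ V                                       ≡⟨ ⟦addLetters⟧ (+ 1) ns (foldr (addLetter -[1+ 0 ]) [] ds) V ⟩
  1ℚ * sumℚ V ns + ⟦ foldr (addLetter -[1+ 0 ]) [] ds ⟧ᴸ V  ≡⟨ cong (_+_ (1ℚ * sumℚ V ns)) (⟦addLetters⟧ -[1+ 0 ] ds [] V) ⟩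
  1ℚ * sumℚ V ns + (- 1ℚ * sumℚ V ds + 0ℚ)               ≡⟨ solve 2 (λ n d → :con 1ℚ :* n :+ (:con (- 1ℚ) :* d :+ :con 0ℚ) := n :- d) refl (sumℚ V ns) (sumℚ V ds) ⟩
  sumℚ V ns - sumℚ V ds                                   ∎
  where
  ns = numeratorLetters a
  ds = denominatorLetters a

L : Letter → RF
L l = letterPoly l /1

∏≢0 : ∀ ls → NonZeroAt sample (∏ ls)
∏≢0 []       = λ ()
∏≢0 (l ∷ ls) = NonZeroAt-⊛ {sample} {letterPoly l} {∏ ls} (letterPoly≢0 l) (∏≢0 ls)

module Expansion {B : Vec RF 5 → ℚ} (ML : Multilinear B) (w : Vec RF 5) (i : Fin 5) (w≢0 : NonZeroᵛ w) where
  open Slot ML w i w≢0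

  B[∏] : ∀ ls → B[ ∏ ls /1 ] ≡ sumℚ (λ l → B[ L l ]) ls
  B[∏] []       = B[1]≡0
  B[∏] (l ∷ ls) = begin
    B[ (letterPoly l ⊛ ∏ ls) /1 ]             ≡⟨ B[⊛] (letterPoly l) (∏ ls) (nz (letterPoly l) (letterPoly≢0 l)) (nz (∏ ls) (∏≢0 ls)) (nz (∏ (l ∷ ls)) (∏≢0 (l ∷ ls))) ⟩
    B[ L l ] + B[ ∏ ls /1 ]                   ≡⟨ cong (_+_ B[ L l ]) (B[∏] ls) ⟩
    B[ L l ] + sumℚ (λ l → B[ L l ]) ls       ∎
    where
    nz : ∀ p → NonZeroAt sample p → NonZeroP p
    nz = NonZeroAt⇒NonZeroP sample

  B[atom] : ∀ a → B[ ⟦ a ⟧ₐ ] ≡ ⟦ divisor a ⟧ᴸ (λ l → B[ L l ])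
  B[atom] a = begin
    B[ n // d ]                                ≡⟨ B[//] n d (nz n n≢0) (nz d d≢0) (nz (n ⊛ d) (NonZeroAt-⊛ {sample} {n} {d} n≢0 d≢0)) ⟩
    B[ n /1 ] - B[ d /1 ]                      ≡⟨ cong₂ _-_ (B[-]-resp-∼ n (∏ ns) (nz n n≢0) (nz (∏ ns) (∏≢0 ns)) numerator)
                                                            (B[-]-resp-∼ d (∏ ds) (nz d d≢0) (nz (∏ ds) (∏≢0 ds)) denominator) ⟩
    B[ ∏ ns /1 ] - B[ ∏ ds /1 ]                ≡⟨ cong₂ _-_ (B[∏] ns) (B[∏] ds) ⟩
    sumℚ (λ l → B[ L l ]) ns - sumℚ (λ l → B[ L l ]) ds   ≡⟨ ⟦divisor⟧ a (λ l → B[ L l ]) ⟨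
    ⟦ divisor a ⟧ᴸ (λ l → B[ L l ])            ∎
    where
    open Factorisation (factorisation a)
    n = num ⟦ a ⟧ₐ
    d = den ⟦ a ⟧ₐ
    ns = numeratorLetters a
    ds = denominatorLetters a
    nz : ∀ p → NonZeroAt sample p → NonZeroP p
    nz = NonZeroAt⇒NonZeroP sample
    n≢0 : NonZeroAt sample n
    n≢0 = NonZeroAt-∼ sample n (∏ ns) numerator (∏≢0 ns)
    d≢0 : NonZeroAt sample d
    d≢0 = NonZeroAt-∼ sample d (∏ ds) denominator (∏≢0 ds)

NonZeroR-L : ∀ l → NonZeroR (L l)
NonZeroR-L l = NonZeroR-/1 (letterPoly l) (NonZeroAt⇒NonZeroP sample (letterPoly l) (letterPoly≢0 l))

NonZeroR-atom : ∀ a → NonZeroR ⟦ a ⟧ₐ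
NonZeroR-atom a = nz (num ⟦ a ⟧ₐ) (numeratorLetters a) numerator , nz (den ⟦ a ⟧ₐ) (denominatorLetters a) denominator
  where
  open Factorisation (factorisation a)
  nz : ∀ p ls → p ∼ ∏ ls → NonZeroP p
  nz p ls p∼ = NonZeroAt⇒NonZeroP sample p (NonZeroAt-∼ sample p (∏ ls) p∼ (∏≢0 ls))

Expands : ∀ k → (Vec RF k → ℚ) → Set
Expands k F = ∀ a (v : Vec RF k) j → NonZeroᵛ v → F (v [ j ]≔ ⟦ a ⟧ₐ) ≡ ⟦ divisor a ⟧ᴸ (λ l → F (v [ j ]≔ L l))

Multilinear⇒Expands : ∀ {B} → Multilinear B → Expands 5 B
Multilinear⇒Expands ML a v j v≢0 = Expansion.B[atom] ML v j v≢0 a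

expand : ∀ {k} F → Expands k F → ∀ as → F (Vec.map ⟦_⟧ₐ as) ≡ ⟦ Vec.map divisor as ⟧ᴹ (F ∘ Vec.map L)
expand F F-expands []       = sym (⟦[]⟧ᴹ (F ∘ Vec.map L))
expand F F-expands (a ∷ as) = begin
  F (⟦ a ⟧ₐ ∷ Vec.map ⟦_⟧ₐ as)
    ≡⟨ F-expands a (L δ₁₂ ∷ Vec.map ⟦_⟧ₐ as) zero v≢0 ⟩
  ⟦ divisor a ⟧ᴸ (λ l → F (L l ∷ Vec.map ⟦_⟧ₐ as))
    ≡⟨ Linear.cong-pointwise (Linear-⟦⟧ᴸ (divisor a)) (λ l → expand (F ∘ (L l ∷_)) (tail-expands l) as) ⟩
  ⟦ divisor a ⟧ᴸ (λ l → ⟦ Vec.map divisor as ⟧ᴹ (F ∘ Vec.map L ∘ (l ∷_)))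
    ≡⟨ ⟦∷⟧ᴹ (divisor a) (Vec.map divisor as) (F ∘ Vec.map L) ⟨
  ⟦ Vec.map divisor (a ∷ as) ⟧ᴹ (F ∘ Vec.map L)
    ∎
  where
  v≢0 : NonZeroᵛ (L δ₁₂ ∷ Vec.map ⟦_⟧ₐ as)
  v≢0 zero    = NonZeroR-L δ₁₂
  v≢0 (suc j) = subst NonZeroR (sym (lookupV-map ⟦_⟧ₐ as j)) (NonZeroR-atom (lookupV as j))
  tail-expands : ∀ l → Expands _ (F ∘ (L l ∷_))
  tail-expands l a v j v≢0 = F-expands a (L l ∷ v) (suc j) λ { zero → NonZeroR-L l ; (suc j) → v≢0 j }

letterTensor : AtomTensor → List (Term 5)
letterTensor = map (λ { (c , as) → c , Vec.map divisor as })

evalT-letterTensor : ∀ {B} → Multilinear B → ∀ t → evalT B ⟦ t ⟧ᵀ ≡ ⟦ letterTensor t ⟧ˢ (B ∘ Vec.map L)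
evalT-letterTensor {B} ML []             = refl
evalT-letterTensor {B} ML ((c , as) ∷ t) =
  cong₂ (λ x y → fromℤ c * x + y) (expand B (Multilinear⇒Expands ML) as) (evalT-letterTensor ML t)

Perm : Set
Perm = Vec (Fin 5) 5

_∘ₚ_ : Perm → Perm → Perm
σ ∘ₚ τ = Vec.map (lookupV σ) τ

renameP-∘ₚ : ∀ σ τ p → renameP (lookupV (σ ∘ₚ τ)) p ≈ₚ renameP (lookupV σ) (renameP (lookupV τ) p)
renameP-∘ₚ σ τ p ρ = begin
  evalP ρ (renameP (lookupV (σ ∘ₚ τ)) p)             ≡⟨ evalP-renameP ρ (lookupV (σ ∘ₚ τ)) p ⟩
  evalP (ρ ∘ lookupV (σ ∘ₚ τ)) p                     ≡⟨ evalP-cong (λ i → cong ρ (lookupV-map (lookupV σ) τ i)) p ⟩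
  evalP (ρ ∘ lookupV σ ∘ lookupV τ) p                ≡⟨ evalP-renameP ρ (lookupV σ ∘ lookupV τ) p ⟨
  evalP ρ (renameP (lookupV σ ∘ lookupV τ) p)        ≡⟨ renameP-∘ (lookupV σ) (lookupV τ) p ρ ⟨
  evalP ρ (renameP (lookupV σ) (renameP (lookupV τ) p))  ∎

preimage : Perm → Fin 5 → Fin 5
preimage σ i = foldr (λ j k → if does (lookupV σ j ≟ i) then j else k) zero (allFin 5)

open Rearrangement (Vecₚ.≡-dec {A = Fin 5} {n = 5} _≟_)

-- Stated for an arbitrary list so that conversion checking never unfolds perms5.
record TranspositionStable (σs : List Perm) : Set where
  field
    invertible        : All (λ σ → ∀ i → preimage σ (lookupV σ i) ≡ i) σs
    sgn-transposition : All (λ σ → ∀ g → sgn (σ ∘ₚ transposition g) ≡ - sgn σ) σs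
    rearranged        : ∀ g → T (rearranges (map (_∘ₚ transposition g) σs) σs)

perms5-stable : TranspositionStable perms5
perms5-stable = record
  { invertible        = from-yes (All.all? (λ σ → all? λ i → preimage σ (lookupV σ i) ≟ i) perms5)
  ; sgn-transposition = from-yes (All.all? (λ σ → all? λ g → sgn (σ ∘ₚ transposition g) ℚ.≟ - sgn σ) perms5)
  ; rearranged        = from-yes (all? λ g → T? (rearranges (map (_∘ₚ transposition g) perms5) perms5))
  }

-- The alternant

module Alternant {B : Vec RF 5 → ℚ} (ML : Multilinear B) {σs : List Perm} (stable : TranspositionStable σs) where
  open TranspositionStable stable

  B⟨_⟩ : Perm → Vec Letter 5 → ℚ
  B⟨ σ ⟩ J = B (renameᵛ (lookupV σ) (Vec.map L J))

  alternant : Vec Letter 5 → ℚ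
  alternant J = sumℚ (λ σ → sgn σ * B⟨ σ ⟩ J) σs

  B⟨⟩-act : ∀ {σ} → σ ∈ σs → ∀ g J → B⟨ σ ⟩ (Vec.map (act g) J) ≡ B⟨ σ ∘ₚ transposition g ⟩ J
  B⟨⟩-act {σ} σ∈ g J@(_ ∷ _ ∷ _ ∷ _ ∷ _ ∷ []) =
    B-resp-∼ ML (Vec.map p J) (Vec.map q J)
      (λ j → subst NonZeroP (sym (lookupV-map p J j)) (p≢0 (lookupV J j)))
      (λ j → subst NonZeroP (sym (lookupV-map q J j)) (q≢0 (lookupV J j)))
      (λ j → subst₂ _∼_ (sym (lookupV-map p J j)) (sym (lookupV-map q J j)) (p∼q (lookupV J j)))
    where
    t = transposition g
    p q : Letter → Poly
    p l = renameP (lookupV σ) (letterPoly (act g l))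
    q l = renameP (lookupV (σ ∘ₚ t)) (letterPoly l)
    p≢0 : ∀ l → NonZeroP (p l)
    p≢0 l = renameP-resp-NonZeroP {τ = preimage σ} (All.lookup invertible σ∈) (letterPoly (act g l))
              (NonZeroAt⇒NonZeroP sample (letterPoly (act g l)) (letterPoly≢0 (act g l)))
    q∼p : ∀ l → q l ∼ p l
    q∼p l = ≈ₚ-∼-trans (q l) (renameP (lookupV σ) (renameP (lookupV t) (letterPoly l))) (p l)
      (renameP-∘ₚ σ t (letterPoly l))
      (renameP-resp-∼ (lookupV σ) {renameP (lookupV t) (letterPoly l)} {letterPoly (act g l)} (act-letterPoly g l))
    p∼q : ∀ l → p l ∼ q l
    p∼q l = ∼-sym (q l) (p l) (q∼p l)
    q≢0 : ∀ l → NonZeroP (q l)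
    q≢0 l = NonZeroP-∼ (q l) (p l) (q∼p l) (p≢0 l)

  alternant-antisymmetric : ∀ g J → alternant (Vec.map (act g) J) ≡ - alternant J
  alternant-antisymmetric g J = begin
    sumℚ (λ σ → sgn σ * B⟨ σ ⟩ (Vec.map (act g) J)) σs
      ≡⟨ sumℚ-cong-∈ σs (λ {σ} σ∈ → cong (sgn σ *_) (B⟨⟩-act σ∈ g J)) ⟩
    sumℚ (λ σ → sgn σ * B⟨ σ ∘ₚ t ⟩ J) σs
      ≡⟨ sumℚ-cong-∈ σs (λ {σ} σ∈ → flip σ (All.lookup sgn-transposition σ∈ g)) ⟩
    sumℚ (λ σ → - f (σ ∘ₚ t)) σs
      ≡⟨ sumℚ-neg (f ∘ (_∘ₚ t)) σs ⟩
    - sumℚ (f ∘ (_∘ₚ t)) σs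
      ≡⟨ cong -_ (sumℚ-map f (_∘ₚ t) σs) ⟨
    - sumℚ f (map (_∘ₚ t) σs)
      ≡⟨ cong -_ (sumℚ-rearranges f (map (_∘ₚ t) σs) σs (rearranged g)) ⟩
    - sumℚ f σs
      ∎
    where
    t = transposition g
    f : Perm → ℚ
    f τ = sgn τ * B⟨ τ ⟩ J
    flip : ∀ σ → sgn (σ ∘ₚ t) ≡ - sgn σ → sgn σ * B⟨ σ ∘ₚ t ⟩ J ≡ - f (σ ∘ₚ t)
    flip σ sgn≡ = sym (begin
      - (sgn (σ ∘ₚ t) * B⟨ σ ∘ₚ t ⟩ J)   ≡⟨ cong (λ s → - (s * B⟨ σ ∘ₚ t ⟩ J)) sgn≡ ⟩
      - (- sgn σ * B⟨ σ ∘ₚ t ⟩ J)        ≡⟨ solve 2 (λ s x → :- (:- s :* x) := s :* x) refl (sgn σ) (B⟨ σ ∘ₚ t ⟩ J) ⟩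
      sgn σ * B⟨ σ ∘ₚ t ⟩ J              ∎)

-- One reduced word for every element of S₅: the products c₀ c₁ c₂ c₃ with c_k
-- an initial segment of s_k s_{k-1} ⋯ s_0.
reducedWords : List Word
reducedWords = foldr (λ chain ws → concatMap (λ u → map (u ++_) ws) (inits chain)) ([] ∷ [])
  ((# 0 ∷ []) ∷ (# 1 ∷ # 0 ∷ []) ∷ (# 2 ∷ # 1 ∷ # 0 ∷ []) ∷ (# 3 ∷ # 2 ∷ # 1 ∷ # 0 ∷ []) ∷ [])

F₀-vanishes : vanishes 5 reducedWords (merge (letterTensor F₀-symbolSh)) ≡ true
F₀-vanishes = refl

alternated-symbol-vanishes : ∀ {B} → Multilinear B → ∀ {σs} → TranspositionStable σs → ∀ F t →
  SymbSh F ≡ ⟦ t ⟧ᵀ → vanishes 5 reducedWords (merge (letterTensor t)) ≡ true →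
  sumℚ (λ σ → sgn σ * evalT (B ∘ renameᵛ (lookupV σ)) (SymbSh F)) σs ≡ 0ℚ
alternated-symbol-vanishes {B} ML {σs} stable F t F≡t t-vanishes = begin
  sumℚ (λ σ → sgn σ * evalT (B ∘ renameᵛ (lookupV σ)) (SymbSh F)) σs
    ≡⟨ sumℚ-cong-∈ σs expand-σ ⟩
  sumℚ (λ σ → sgn σ * ⟦ letterTensor t ⟧ˢ B⟨ σ ⟩) σs
    ≡⟨ Linear.sumℚ-homo (Linear-⟦⟧ˢ (letterTensor t)) sgn B⟨_⟩ σs ⟨
  ⟦ letterTensor t ⟧ˢ alternant
    ≡⟨ ⟦merge⟧ (letterTensor t) alternant ⟨
  ⟦ merge (letterTensor t) ⟧ˢ alternant
    ≡⟨ vanishes-sound 5 reducedWords (merge (letterTensor t)) alternant t-vanishes (Alternating-generators alternant-antisymmetric reducedWords) ⟩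
  0ℚ ∎
  where
  open TranspositionStable stable
  open Alternant ML stable
  expand-σ : ∀ {σ} → σ ∈ σs → sgn σ * evalT (B ∘ renameᵛ (lookupV σ)) (SymbSh F) ≡ sgn σ * ⟦ letterTensor t ⟧ˢ B⟨ σ ⟩
  expand-σ {σ} σ∈ = trans (cong (λ u → sgn σ * evalT (B ∘ renameᵛ (lookupV σ)) u) F≡t)
    (cong (sgn σ *_) (evalT-letterTensor (Multilinear-rename {lookupV σ} {preimage σ} (All.lookup invertible σ∈) ML) t))

theorem6p5 : IsZeroT (SymbSh (Alt5 F₀))
theorem6p5 B ML = trans (evalT-SymbSh-Alt5 B F₀) (alternated-symbol-vanishes ML perms5-stable F₀ F₀-symbolSh SymbSh-F₀ F₀-vanishes)
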